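{- Let $\alpha=\beta=1$, $n\ge1$, and $\tau,\tau'\in\{0,1\}^n$ with $\tau\prec\tau'$. Then $f_n(\tau')-f_n(\tau)$ is a polynomial in $q$ with nonnegative coefficients.
   Context: For a partition $\lambda=(\lambda_1\ge\dots\ge\lambda_k\ge0)$ (zero parts allowed and counted), its Young diagram has $k$ left-justified rows of lengths $\lambda_1,\dots,\lambda_k$. For $\tau\in\{0,1\}^n$ let $p=p_1\cdots p_{n+1}\in\{S,W\}^{n+1}$ with $p_1=S$ and $p_{i+1}=S$ iff $\tau_i=1$; if $p$ has $k$ letters $S$ and $m$ letters $W$ and the $j$-th $S$ is preceded by $w_j$ letters $W$, set $\lambda(\tau)=(m-w_1,\dots,m-w_k)$. For $\tau,\tau'\in\{0,1\}^n$ with the same number of $1$'s, $\tau\prec\tau'$ means the Young diagram of $\lambda(\tau)$ is contained in that of $\lambda(\tau')$. A permutation tableau of shape $\lambda$ is a $0/1$ filling of the Young diagram such that (1) every column contains at least one $1$, and (2) no $0$ has both a $1$ above it in its column and a $1$ to its left in its row. Its weight $\mathrm{wt}(\mathcal T)$ is the number of $1$'s minus the number of columns. With $\alpha=\beta=1$, $f_n(\tau)=\sum_{\mathcal T}q^{\mathrm{wt}(\mathcal T)}$, summed over all permutation tableaux of shape $\lambda(\tau)$; this is the unnormalized stationary weight of configuration $\tau$ in the PASEP on $n$ sites with $\alpha=\beta=1$. -}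

module Defs where

open import Data.Bool using (Bool; true; false; _∧_; not; if_then_else_)
open import Data.Nat using (ℕ; zero; suc; _+_; _∸_; _≤_; _≡ᵇ_)
open import Data.List using (List; []; _∷_; length; map; upTo; filterᵇ; concatMap)
open import Data.Bool.ListAction using (all; any)
open import Data.Nat.ListAction using (sum)
open import Data.Vec using (Vec; toList)
open import Data.Product using (_×_)
open import Relation.Binary.PropositionalEquality using (_≡_)

data Letter : Set where
  S W : Letter

word : ∀ {n} → Vec Bool n → List Letter
word τ = S ∷ map (λ b → if b then S else W) (toList τ)

countW : List Letter → ℕ
countW [] = 0
countW (S ∷ p) = countW p
countW (W ∷ p) = suc (countW p)

wsBefore : ℕ → List Letter → List ℕ
wsBefore w [] = []
wsBefore w (S ∷ p) = w ∷ wsBefore w p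
wsBefore w (W ∷ p) = wsBefore (suc w) p

shape : ∀ {n} → Vec Bool n → List ℕ
shape τ = map (λ w → countW (word τ) ∸ w) (wsBefore 0 (word τ))

-- i-th part, with parts beyond the length read as 0
part : List ℕ → ℕ → ℕ
part [] _ = 0
part (x ∷ _) zero = x
part (_ ∷ xs) (suc i) = part xs i

_⊆ᵈ_ : List ℕ → List ℕ → Set
λ₁ ⊆ᵈ μ = ∀ i → part λ₁ i ≤ part μ i

numOnes : ∀ {n} → Vec Bool n → ℕ
numOnes v = length (filterᵇ (λ b → b) (toList v))

_≺_ : ∀ {n} → Vec Bool n → Vec Bool n → Set
τ ≺ τ' = (numOnes τ ≡ numOnes τ') × (shape τ ⊆ᵈ shape τ')

-- A filling of shape λ = (λ₁,…,λ_k) is a list of k rows, row i being a list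
-- of λ_i Booleans (true = 1, false = 0).  Row 0 is the top row, column 0 the
-- leftmost column (English convention).

Filling : Set
Filling = List (List Bool)

allRows : ℕ → List (List Bool)
allRows zero = [] ∷ []
allRows (suc c) = concatMap (λ r → (false ∷ r) ∷ (true ∷ r) ∷ []) (allRows c)

allFillings : List ℕ → List Filling
allFillings [] = [] ∷ []
allFillings (c ∷ cs) = concatMap (λ r → map (r ∷_) (allFillings cs)) (allRows c)

getB : List Bool → ℕ → Bool
getB [] _ = false
getB (x ∷ _) zero = x
getB (_ ∷ xs) (suc j) = getB xs j

getRow : Filling → ℕ → List Bool
getRow [] _ = []
getRow (r ∷ _) zero = r
getRow (_ ∷ rs) (suc i) = getRow rs i

entry : Filling → ℕ → ℕ → Bool
entry F i j = getB (getRow F i) j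

numCols : List ℕ → ℕ
numCols [] = 0
numCols (c ∷ _) = c

columnsOK : List ℕ → Filling → Bool
columnsOK sh F = all (λ j → any (λ i → entry F i j) (upTo (length sh))) (upTo (numCols sh))

badZero : Filling → ℕ → ℕ → Bool
badZero F i j = not (entry F i j) ∧ any (λ i' → entry F i' j) (upTo i)
                                  ∧ any (λ j' → entry F i j') (upTo j)

zerosOK : List ℕ → Filling → Bool
zerosOK sh F = all (λ i → all (λ j → not (badZero F i j)) (upTo (part sh i))) (upTo (length sh))

isPermTableau : List ℕ → Filling → Bool
isPermTableau sh F = columnsOK sh F ∧ zerosOK sh F

countOnes : Filling → ℕ
countOnes F = sum (map (λ r → length (filterᵇ (λ b → b) r)) F)

-- wt(T) = (#1's) − (#columns); truncated subtraction is exact for permutation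
-- tableaux since each column contains a 1.
wt : List ℕ → Filling → ℕ
wt sh F = countOnes F ∸ numCols sh

permTableaux : List ℕ → List Filling
permTableaux sh = filterᵇ (isPermTableau sh) (allFillings sh)

-- f_n(τ) = Σ_T q^{wt T}, represented by its coefficients:
-- coeff τ d = [q^d] f_n(τ) = number of permutation tableaux of shape λ(τ) of weight d.
coeff : ∀ {n} → Vec Bool n → ℕ → ℕ
coeff τ d = length (filterᵇ (λ T → wt (shape τ) T ≡ᵇ d) (permTableaux (shape τ)))

{-# OPTIONS --safe #-}
-- The generating function f of a shape satisfies the corner recursion
--   f(u10v) = q f(u01v) + f(u0v) + f(u1v):
-- sort the tableaux of shape λ(u10v) by the corner cell created by the factor 10.  If it holds
-- a 1 with another 1 above it, the cell can be deleted, lowering the weight by one; a 1 alone in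
-- its column is deleted together with its column; and a 0 forces its whole row to be 0, so the
-- row is deleted.  Expanding u01v and u10v at a common corner and comparing the three terms
-- shows f(u01v) ≤ f(u10v) coefficientwise, by induction on the length plus the number of
-- inversions of v; when v has no 0, the 1 of the swapped pair is an empty row, which does not
-- change the count.  Finally, τ ≺ τ′ implies that τ′ is reached from τ by swaps 01 → 10.
module Submission where

open import Defs
open import Data.Bool using (Bool; true; false; _∧_; _∨_; not; T; if_then_else_)
open import Data.Bool.ListAction using (all; any)
open import Data.Bool.Properties using (T-≡; T-not-≡; T-∧; T?)
open import Data.Empty using (⊥; ⊥-elim)
open import Data.List
  using (List; []; _∷_; _++_; length; map; filterᵇ; upTo; concatMap; drop; foldr; replicate; reverse; _ʳ++_; _∷ʳ_)
open import Data.List.Membership.Propositional using (_∈_; lose; find)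
open import Data.List.Membership.Propositional.Properties
  using (∈-∃++; ∈-++⁻; ∈-++⁺ˡ; ∈-++⁺ʳ; ∈-map⁺; ∈-map⁻; ∈-filter⁻; ∈-filter⁺; ∈-upTo⁺; ∈-upTo⁻;
         ∈-concatMap⁺; ∈-concatMap⁻)
open import Data.List.Properties
  using (length-++; length-map; length-replicate; map-∘; map-cong; map-id-local; map-++; ∷-injectiveʳ;
         ʳ++-defn; ʳ++-ʳ++; reverse-involutive; ∷ʳ-++)
open import Data.List.Relation.Binary.Pointwise using (Pointwise; []; _∷_; Pointwise-length) renaming (++⁺ to _++ₚ_)
open import Data.List.Relation.Binary.Subset.Propositional using (_⊆_)
open import Data.List.Relation.Unary.All as All using (All; []; _∷_)
open import Data.List.Relation.Unary.All.Properties using (all⁺; all⁻) renaming (map⁺ to All-map⁺)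
import Data.List.Relation.Unary.AllPairs as AllPairs
import Data.List.Relation.Unary.AllPairs.Properties as AllPairs
open import Data.List.Relation.Unary.Any using (here; there)
open import Data.List.Relation.Unary.Any.Properties using (any⁺; any⁻)
open import Data.List.Relation.Unary.Unique.Propositional using (Unique; []; _∷_)
import Data.List.Relation.Unary.Unique.Propositional.Properties as Unique
open import Data.Nat using (ℕ; zero; suc; pred; _+_; _∸_; _≤_; _<_; _≡ᵇ_; z≤n; s≤s)
open import Data.Nat.Induction using (<-wellFounded)
open import Data.Nat.Properties
open import Algebra.Properties.CommutativeSemigroup +-commutativeSemigroup using (interchange; x∙yz≈y∙xz; xy∙z≈xz∙y)
open import Data.Product using (∃-syntax; _×_; _,_; proj₁; proj₂)
open import Data.Sum using (_⊎_; inj₁; inj₂)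
import Data.Sum as Sum
open import Data.Vec using (Vec; toList)
open import Data.Vec.Properties using (length-toList)
open import Function using (_∘_; case_of_; Equivalence; _⇔_; mk⇔)
open import Induction.WellFounded using (Acc; acc)
open import Relation.Binary.Construct.Closure.ReflexiveTransitive using (Star; ε; _◅_; _◅◅_; gmap)
open import Relation.Binary.Definitions using (tri<; tri≈; tri>)
open import Relation.Binary.PropositionalEquality
open import Relation.Nullary using (¬_; yes; no)

open Equivalence using (to; from)

length-insert : ∀ {A : Set} (w : List A) x v → length (w ++ x ∷ v) ≡ suc (length (w ++ v))
length-insert [] x v = refl
length-insert (y ∷ w) x v = cong suc (length-insert w x v)

count : {A : Set} → (A → Bool) → List A → ℕ
count p xs = length (filterᵇ p xs)

module _ {A : Set} where

  count-∧-split : (p q : A → Bool) (xs : List A) →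
    count p xs ≡ count (λ x → p x ∧ q x) xs + count (λ x → p x ∧ not (q x)) xs
  count-∧-split p q [] = refl
  count-∧-split p q (x ∷ xs) with p x | q x
  ... | true  | true  = cong suc (count-∧-split p q xs)
  ... | true  | false = trans (cong suc (count-∧-split p q xs)) (sym (+-suc _ _))
  ... | false | _     = count-∧-split p q xs

  length-filterᵇ-filterᵇ : (p q : A → Bool) (xs : List A) →
    length (filterᵇ q (filterᵇ p xs)) ≡ count (λ x → p x ∧ q x) xs
  length-filterᵇ-filterᵇ p q [] = refl
  length-filterᵇ-filterᵇ p q (x ∷ xs) with p x
  ... | false = length-filterᵇ-filterᵇ p q xs
  ... | true with q x
  ...   | true  = cong suc (length-filterᵇ-filterᵇ p q xs)
  ...   | false = length-filterᵇ-filterᵇ p q xs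

  count-none : (p : A → Bool) (xs : List A) → (∀ {x} → x ∈ xs → ¬ T (p x)) → count p xs ≡ 0
  count-none p [] none = refl
  count-none p (x ∷ xs) none with p x in px
  ... | true  = ⊥-elim (none (here refl) (subst T (sym px) _))
  ... | false = count-none p xs (none ∘ there)

  unique-⊆⇒length-≤ : {xs ys : List A} → Unique xs → xs ⊆ ys → length xs ≤ length ys
  unique-⊆⇒length-≤ {[]} _ _ = z≤n
  unique-⊆⇒length-≤ {x ∷ xs} (x≢xs ∷ xs!) xs⊆ys
    with ys₁ , ys₂ , refl ← ∈-∃++ (xs⊆ys (here refl)) =
    subst (suc (length xs) ≤_) (sym (length-insert ys₁ x ys₂)) (s≤s (unique-⊆⇒length-≤ xs! xs⊆ys₁++ys₂))
    where
    xs⊆ys₁++ys₂ : xs ⊆ ys₁ ++ ys₂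
    xs⊆ys₁++ys₂ y∈xs with ∈-++⁻ ys₁ (xs⊆ys (there y∈xs))
    ... | inj₁ y∈ys₁         = ∈-++⁺ˡ y∈ys₁
    ... | inj₂ (here refl)   = ⊥-elim (All.lookup x≢xs y∈xs refl)
    ... | inj₂ (there y∈ys₂) = ∈-++⁺ʳ ys₁ y∈ys₂

module _ {A B : Set} (p : A → Bool) (q : B → Bool) (φ : A → B) (ψ : B → A) where

  count-≤-by-injection : {xs : List A} {ys : List B} → Unique xs →
    (∀ {x} → x ∈ xs → T (p x) → φ x ∈ ys × T (q (φ x)) × ψ (φ x) ≡ x) →
    count p xs ≤ count q ys
  count-≤-by-injection {xs} {ys} xs! into = begin
      count p xs               ≡⟨ sym (length-map φ chosen) ⟩
      length (map φ chosen)    ≤⟨ unique-⊆⇒length-≤ image! image⊆ ⟩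
      count q ys               ∎
    where
    open ≤-Reasoning
    chosen = filterᵇ p xs
    into′ : ∀ {x} → x ∈ chosen → φ x ∈ ys × T (q (φ x)) × ψ (φ x) ≡ x
    into′ x∈ = let (x∈xs , px) = ∈-filter⁻ (T? ∘ p) x∈ in into x∈xs px
    retract : map ψ (map φ chosen) ≡ chosen
    retract = trans (sym (map-∘ chosen)) (map-id-local (All.tabulate (proj₂ ∘ proj₂ ∘ into′)))
    image! : Unique (map φ chosen)
    image! = Unique.map⁻ {f = ψ} (subst Unique (sym retract) (Unique.filter⁺ (T? ∘ p) xs!))
    image⊆ : map φ chosen ⊆ filterᵇ q ys
    image⊆ y∈ with x , x∈ , refl ← ∈-map⁻ φ y∈ =
      ∈-filter⁺ (T? ∘ q) (proj₁ (into′ x∈)) (proj₁ (proj₂ (into′ x∈)))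

count-≡-by-bijection : {A B : Set} (p : A → Bool) (q : B → Bool) (φ : A → B) (ψ : B → A)
  {xs : List A} {ys : List B} → Unique xs → Unique ys →
  (∀ {x} → x ∈ xs → T (p x) → φ x ∈ ys × T (q (φ x)) × ψ (φ x) ≡ x) →
  (∀ {y} → y ∈ ys → T (q y) → ψ y ∈ xs × T (p (ψ y)) × φ (ψ y) ≡ y) →
  count p xs ≡ count q ys
count-≡-by-bijection p q φ ψ xs! ys! into onto = ≤-antisym
  (count-≤-by-injection p q φ ψ xs! into)
  (count-≤-by-injection q p ψ φ ys! onto)

module _ {A B : Set} where

  unique-concatMap : (f : A → List B) (h : B → A) {xs : List A} → Unique xs →
    (∀ x → Unique (f x)) → (∀ {x y} → y ∈ f x → h y ≡ x) → Unique (concatMap f xs)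
  unique-concatMap f h xs! f! h-retracts =
    Unique.concat⁺ (All-map⁺ (All.tabulate (λ {x} _ → f! x))) (AllPairs.map⁺ {f = f} (AllPairs.map disjoint xs!))
    where
    disjoint : ∀ {x x′} → x ≢ x′ → ∀ {y} → ¬ (y ∈ f x × y ∈ f x′)
    disjoint x≢x′ (y∈fx , y∈fx′) = x≢x′ (trans (sym (h-retracts y∈fx)) (h-retracts y∈fx′))

  ∈-concatMap-∃ : (f : A → List B) {xs : List A} {y : B} → y ∈ concatMap f xs → ∃[ x ] x ∈ xs × y ∈ f x
  ∈-concatMap-∃ f y∈ = find (∈-concatMap⁻ f y∈)

HasShape : List ℕ → Filling → Set
HasShape = Pointwise (λ c r → length r ≡ c)

prependBit : List Bool → List (List Bool)
prependBit r = (false ∷ r) ∷ (true ∷ r) ∷ []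

withTopRow : List ℕ → List Bool → List Filling
withTopRow cs r = map (r ∷_) (allFillings cs)

allRows-unique : ∀ c → Unique (allRows c)
allRows-unique zero = [] ∷ []
allRows-unique (suc c) = unique-concatMap prependBit (drop 1) (allRows-unique c)
  (λ r → ((λ ()) ∷ []) ∷ [] ∷ [])
  (λ { (here refl) → refl ; (there (here refl)) → refl })

allRows-sound : ∀ c {r} → r ∈ allRows c → length r ≡ c
allRows-sound zero (here refl) = refl
allRows-sound (suc c) r∈ with r₀ , r₀∈ , r∈two ← ∈-concatMap-∃ prependBit {allRows c} r∈ with r∈two
... | here refl         = cong suc (allRows-sound c r₀∈)
... | there (here refl) = cong suc (allRows-sound c r₀∈)

allRows-complete : ∀ r → r ∈ allRows (length r)
allRows-complete [] = here refl
allRows-complete (false ∷ r) =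
  ∈-concatMap⁺ prependBit {xs = allRows (length r)} (lose (allRows-complete r) (here refl))
allRows-complete (true ∷ r) =
  ∈-concatMap⁺ prependBit {xs = allRows (length r)} (lose (allRows-complete r) (there (here refl)))

allFillings-unique : ∀ sh → Unique (allFillings sh)
allFillings-unique [] = [] ∷ []
allFillings-unique (c ∷ cs) = unique-concatMap (withTopRow cs) (head-or-[]) (allRows-unique c)
  (λ r → Unique.map⁺ ∷-injectiveʳ (allFillings-unique cs))
  (λ y∈ → case ∈-map⁻ _ y∈ of λ { (_ , _ , refl) → refl })
  where
  head-or-[] : Filling → List Bool
  head-or-[] [] = []
  head-or-[] (r ∷ _) = r

allFillings-sound : ∀ sh {F} → F ∈ allFillings sh → HasShape sh F
allFillings-sound [] (here refl) = []
allFillings-sound (c ∷ cs) F∈ with r , r∈ , F∈′ ← ∈-concatMap-∃ (withTopRow cs) {allRows c} F∈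
                              with G , G∈ , refl ← ∈-map⁻ (r ∷_) F∈′ =
  allRows-sound c r∈ ∷ allFillings-sound cs G∈

allFillings-complete : ∀ {sh F} → HasShape sh F → F ∈ allFillings sh
allFillings-complete [] = here refl
allFillings-complete {c ∷ cs} {r ∷ F} (refl ∷ hs) =
  ∈-concatMap⁺ (withTopRow cs) {xs = allRows (length r)}
    (lose (allRows-complete r) (∈-map⁺ (r ∷_) (allFillings-complete hs)))

ZerosAboveOrLeft : (ℕ → ℕ → Bool) → ℕ → ℕ → Set
ZerosAboveOrLeft E i j = (∀ i′ → i′ < i → E i′ j ≡ false) ⊎ (∀ j′ → j′ < j → E i j′ ≡ false)

record IsPermTableau (m : ℕ) (E : ℕ → ℕ → Bool) (L : ℕ → ℕ) : Set where
  field
    column-has-one : ∀ j → j < m → ∃[ i ] E i j ≡ true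
    zero-rule      : ∀ i j → j < L i → E i j ≡ false → ZerosAboveOrLeft E i j

rowLength : Filling → ℕ → ℕ
rowLength F i = length (getRow F i)

module _ (f : ℕ → Bool) (n : ℕ) where

  all-upTo⁻ : T (all f (upTo n)) → ∀ {i} → i < n → T (f i)
  all-upTo⁻ t i<n = All.lookup (all⁺ f (upTo n) t) (∈-upTo⁺ i<n)

  all-upTo⁺ : (∀ {i} → i < n → T (f i)) → T (all f (upTo n))
  all-upTo⁺ h = all⁻ f (All.tabulate (h ∘ ∈-upTo⁻))

  any-upTo⁺ : ∀ {i} → i < n → T (f i) → T (any f (upTo n))
  any-upTo⁺ i<n fi = any⁺ f (lose (∈-upTo⁺ i<n) fi)

  any-upTo-false⁻ : any f (upTo n) ≡ false → ∀ i → i < n → f i ≡ false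
  any-upTo-false⁻ none i i<n with f i in fi
  ... | false = refl
  ... | true  = ⊥-elim (subst T none (any-upTo⁺ i<n (subst T (sym fi) _)))

  any-upTo-false⁺ : (∀ i → i < n → f i ≡ false) → any f (upTo n) ≡ false
  any-upTo-false⁺ none with any f (upTo n) in t
  ... | false = refl
  ... | true with i , i∈ , fi ← find (any⁻ f (upTo n) (subst T (sym t) _)) =
    ⊥-elim (subst T (none i (∈-upTo⁻ i∈)) fi)

getB-true⇒< : ∀ r j → getB r j ≡ true → j < length r
getB-true⇒< (x ∷ r) zero _ = s≤s z≤n
getB-true⇒< (x ∷ r) (suc j) e = s≤s (getB-true⇒< r j e)

entry-true⇒< : ∀ F i j → entry F i j ≡ true → i < length F
entry-true⇒< (r ∷ F) zero j _ = s≤s z≤n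
entry-true⇒< (r ∷ F) (suc i) j e = s≤s (entry-true⇒< F i j e)

rowLength-shape : ∀ {sh F} → HasShape sh F → ∀ i → rowLength F i ≡ part sh i
rowLength-shape [] i = refl
rowLength-shape (ℓ ∷ _) zero = ℓ
rowLength-shape (_ ∷ hs) (suc i) = rowLength-shape hs i

row-nonempty⇒< : ∀ F i {j} → j < rowLength F i → i < length F
row-nonempty⇒< (r ∷ F) zero _ = s≤s z≤n
row-nonempty⇒< (r ∷ F) (suc i) j<ℓ = s≤s (row-nonempty⇒< F i j<ℓ)

no-bad-zero⁻ : ∀ e a b → T (not (not e ∧ a ∧ b)) → e ≡ false → a ≡ false ⊎ b ≡ false
no-bad-zero⁻ false false b _ _ = inj₁ refl
no-bad-zero⁻ false true false _ _ = inj₂ refl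

no-bad-zero⁺ : ∀ e a b → (e ≡ false → a ≡ false ⊎ b ≡ false) → T (not (not e ∧ a ∧ b))
no-bad-zero⁺ true a b _ = _
no-bad-zero⁺ false false b _ = _
no-bad-zero⁺ false true b h with h refl
... | inj₂ refl = _

isPermTableau⇔ : ∀ {sh F} → HasShape sh F →
  T (isPermTableau sh F) ⇔ IsPermTableau (numCols sh) (entry F) (rowLength F)
isPermTableau⇔ {sh} {F} hs = mk⇔ sound complete
  where
  rows≡ : length F ≡ length sh
  rows≡ = sym (Pointwise-length hs)

  sound : T (isPermTableau sh F) → IsPermTableau (numCols sh) (entry F) (rowLength F)
  sound t = record { column-has-one = columns ; zero-rule = zeros }
    where
    columns : ∀ j → j < numCols sh → ∃[ i ] entry F i j ≡ true
    columns j j<m with i , _ , e ← find (any⁻ _ (upTo (length sh))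
                                     (all-upTo⁻ _ (numCols sh) (proj₁ (to T-∧ t)) j<m)) =
      i , to T-≡ e
    zeros : ∀ i j → j < rowLength F i → entry F i j ≡ false → ZerosAboveOrLeft (entry F) i j
    zeros i j j<ℓ e = Sum.map (any-upTo-false⁻ _ i) (any-upTo-false⁻ _ j)
      (no-bad-zero⁻ _ _ _ (all-upTo⁻ _ (part sh i)
         (all-upTo⁻ _ (length sh) (proj₂ (to T-∧ t)) (subst (i <_) rows≡ (row-nonempty⇒< F i j<ℓ)))
         (subst (j <_) (rowLength-shape hs i) j<ℓ)) e)

  complete : IsPermTableau (numCols sh) (entry F) (rowLength F) → T (isPermTableau sh F)
  complete pt =
    from T-∧ (all-upTo⁺ _ _ columns , all-upTo⁺ _ (length sh) (λ {i} _ → all-upTo⁺ _ (part sh i) zeros))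
    where
    open IsPermTableau pt
    columns : ∀ {j} → j < numCols sh → T (any (λ i → entry F i j) (upTo (length sh)))
    columns {j} j<m with i , e ← column-has-one j j<m =
      any-upTo⁺ _ _ (subst (i <_) rows≡ (entry-true⇒< F i j e)) (from T-≡ e)
    zeros : ∀ {i j} → j < part sh i → T (not (badZero F i j))
    zeros {i} {j} j<ℓ = no-bad-zero⁺ _ _ _ λ e →
      Sum.map (any-upTo-false⁺ _ i) (any-upTo-false⁺ _ j)
        (zero-rule i j (subst (j <_) (sym (rowLength-shape hs i)) j<ℓ) e)

ones : List Bool → ℕ
ones = count (λ b → b)

_∨ʳ_ : List Bool → List Bool → List Bool
[] ∨ʳ s = s
(x ∷ r) ∨ʳ [] = x ∷ r
(x ∷ r) ∨ʳ (y ∷ s) = (x ∨ y) ∷ (r ∨ʳ s)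

ones-∨ʳ : ∀ r s → ones (r ∨ʳ s) ≤ ones r + ones s
ones-∨ʳ [] s = ≤-refl
ones-∨ʳ (x ∷ r) [] = m≤m+n _ 0
ones-∨ʳ (true ∷ r) (true ∷ s) = s≤s (≤-trans (ones-∨ʳ r s) (+-monoʳ-≤ (ones r) (n≤1+n _)))
ones-∨ʳ (true ∷ r) (false ∷ s) = s≤s (ones-∨ʳ r s)
ones-∨ʳ (false ∷ r) (true ∷ s) = ≤-trans (s≤s (ones-∨ʳ r s)) (≤-reflexive (sym (+-suc _ _)))
ones-∨ʳ (false ∷ r) (false ∷ s) = ones-∨ʳ r s

getB-∨ʳ : ∀ r s j → getB r j ≡ true ⊎ getB s j ≡ true → getB (r ∨ʳ s) j ≡ true
getB-∨ʳ [] s j (inj₂ e) = e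
getB-∨ʳ (x ∷ r) [] j (inj₁ e) = e
getB-∨ʳ (x ∷ r) (y ∷ s) (suc j) h = getB-∨ʳ r s j h
getB-∨ʳ (true ∷ r) (y ∷ s) zero _ = refl
getB-∨ʳ (false ∷ r) (y ∷ s) zero (inj₂ e) = e

occupiedColumns : Filling → List Bool
occupiedColumns = foldr _∨ʳ_ []

ones-occupiedColumns : ∀ F → ones (occupiedColumns F) ≤ countOnes F
ones-occupiedColumns [] = z≤n
ones-occupiedColumns (r ∷ F) = ≤-trans (ones-∨ʳ r _) (+-monoʳ-≤ (ones r) (ones-occupiedColumns F))

getB-occupiedColumns : ∀ F i j → entry F i j ≡ true → getB (occupiedColumns F) j ≡ true
getB-occupiedColumns (r ∷ F) zero j e = getB-∨ʳ r _ j (inj₁ e)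
getB-occupiedColumns (r ∷ F) (suc i) j e = getB-∨ʳ r _ j (inj₂ (getB-occupiedColumns F i j e))

initial-ones≤ones : ∀ m r → (∀ j → j < m → getB r j ≡ true) → m ≤ ones r
initial-ones≤ones zero r _ = z≤n
initial-ones≤ones (suc m) [] h with () ← h 0 (s≤s z≤n)
initial-ones≤ones (suc m) (x ∷ r) h with refl ← h 0 (s≤s z≤n) =
  s≤s (initial-ones≤ones m r (λ j j<m → h (suc j) (s≤s j<m)))

columns≤countOnes : ∀ m F → (∀ j → j < m → ∃[ i ] entry F i j ≡ true) → m ≤ countOnes F
columns≤countOnes m F hit = ≤-trans
  (initial-ones≤ones m (occupiedColumns F) (λ j j<m → getB-occupiedColumns F _ j (proj₂ (hit j j<m))))
  (ones-occupiedColumns F)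

-- Deleting a zero row, a column, or a corner cell

true≢false : true ≢ false
true≢false ()

Bounded : (ℕ → ℕ → Bool) → (ℕ → ℕ) → Set
Bounded E L = ∀ i j → E i j ≡ true → j < L i

record Corner (L : ℕ → ℕ) (i₀ a : ℕ) : Set where
  field
    corner-row : L i₀ ≡ suc a
    rows-below : ∀ i → i₀ < i → L i ≤ a

  long-row⇒above : ∀ {i} → a < L i → i ≤ i₀
  long-row⇒above {i} a<ℓ with i ≤? i₀
  ... | yes i≤i₀ = i≤i₀
  ... | no i≰i₀  = ⊥-elim (<-irrefl refl (<-≤-trans a<ℓ (rows-below i (≰⇒> i≰i₀))))

-- skip k enumerates ℕ ∖ {k} in increasing order.
skip : ℕ → ℕ → ℕ
skip zero i = suc i
skip (suc k) zero = zero
skip (suc k) (suc i) = suc (skip k i)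

skip-below : ∀ {a j} → j < a → skip a j ≡ j
skip-below {suc a} {zero} _ = refl
skip-below {suc a} {suc j} (s≤s j<a) = cong suc (skip-below j<a)

skip-above : ∀ {a j} → a ≤ j → skip a j ≡ suc j
skip-above {zero} _ = refl
skip-above {suc a} {suc j} (s≤s a≤j) = cong suc (skip-above a≤j)

skip-mono-< : ∀ k {i i′} → i′ < i → skip k i′ < skip k i
skip-mono-< zero i′<i = s≤s i′<i
skip-mono-< (suc k) {suc i} {zero} _ = s≤s z≤n
skip-mono-< (suc k) {suc i} {suc i′} (s≤s i′<i) = s≤s (skip-mono-< k i′<i)

skip-cancel-< : ∀ k {i i′} → skip k i′ < skip k i → i′ < i
skip-cancel-< zero (s≤s lt) = lt
skip-cancel-< (suc k) {suc i} {zero} _ = s≤s z≤n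
skip-cancel-< (suc k) {suc i} {suc i′} (s≤s lt) = s≤s (skip-cancel-< k lt)
skip-cancel-< (suc k) {zero} {i′} ()

skip-onto : ∀ k i → i ≢ k → ∃[ i′ ] skip k i′ ≡ i
skip-onto zero zero i≢k = ⊥-elim (i≢k refl)
skip-onto zero (suc i) _ = i , refl
skip-onto (suc k) zero _ = zero , refl
skip-onto (suc k) (suc i) i≢k with i′ , e ← skip-onto k i (i≢k ∘ cong suc) = suc i′ , cong suc e

skip-bound : ∀ {a m} j → a ≤ m → skip a j < suc m → j < m
skip-bound {zero} j _ (s≤s lt) = lt
skip-bound {suc a} {suc m} zero _ _ = s≤s z≤n
skip-bound {suc a} {suc m} (suc j) (s≤s a≤m) (s≤s lt) = s≤s (skip-bound j a≤m lt)

skip≤suc : ∀ k i → skip k i ≤ suc i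
skip≤suc zero i = ≤-refl
skip≤suc (suc k) zero = z≤n
skip≤suc (suc k) (suc i) = s≤s (skip≤suc k i)

corner-column : ∀ {E L i₀ a} → Bounded E L → Corner L i₀ a → ∀ i → E i a ≡ true → i ≤ i₀
corner-column bounded corner i e = Corner.long-row⇒above corner (bounded i _ e)

zero-corner⇒zero-row : ∀ {m E L i₀ a} → IsPermTableau m E L → Bounded E L → Corner L i₀ a → a < m →
  E i₀ a ≡ false → ∀ j → E i₀ j ≡ false
-- Column a has its 1 above the corner 0, so by the zero rule nothing to the left of it is 1.
zero-corner⇒zero-row {E = E} {i₀ = i₀} {a} pt bounded corner a<m corner0 j with E i₀ j in e
... | false = refl
... | true with i , one ← IsPermTableau.column-has-one pt a a<m
             | IsPermTableau.zero-rule pt i₀ a (≤-reflexive (sym (Corner.corner-row corner))) corner0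
...   | inj₁ clear-above = ⊥-elim (true≢false (trans (sym one) (clear-above i i<i₀)))
  where
  i<i₀ : i < i₀
  i<i₀ = ≤∧≢⇒< (corner-column bounded corner i one) λ { refl → true≢false (trans (sym one) corner0) }
...   | inj₂ clear-left = ⊥-elim (true≢false (trans (sym e) (clear-left j j<a)))
  where
  j<a : j < a
  j<a = ≤∧≢⇒< (≤-pred (subst (j <_) (Corner.corner-row corner) (bounded i₀ j e)))
                λ { refl → true≢false (trans (sym e) corner0) }

module DeleteRow (i₀ : ℕ) {EF EG : ℕ → ℕ → Bool} {LF LG : ℕ → ℕ}
  (EG≡ : ∀ i j → EG i j ≡ EF (skip i₀ i) j) (LG≡ : ∀ i → LG i ≡ LF (skip i₀ i))
  (zero-row : ∀ j → EF i₀ j ≡ false) where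

  delete : ∀ {m} → IsPermTableau m EF LF → IsPermTableau m EG LG
  delete {m} pt = record { column-has-one = columns ; zero-rule = zeros }
    where
    open IsPermTableau pt
    columns : ∀ j → j < m → ∃[ i ] EG i j ≡ true
    columns j j<m with i , one ← column-has-one j j<m
                  with i′ , refl ← skip-onto i₀ i (λ { refl → true≢false (trans (sym one) (zero-row j)) }) =
      i′ , trans (EG≡ i′ j) one
    zeros : ∀ i j → j < LG i → EG i j ≡ false → ZerosAboveOrLeft EG i j
    zeros i j j<ℓ e = Sum.map
      (λ clear-above i′ i′<i → trans (EG≡ i′ j) (clear-above _ (skip-mono-< i₀ i′<i)))
      (λ clear-left j′ j′<j → trans (EG≡ i j′) (clear-left j′ j′<j))
      (zero-rule (skip i₀ i) j (subst (j <_) (LG≡ i) j<ℓ) (trans (sym (EG≡ i j)) e))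

  insert : ∀ {m} → IsPermTableau m EG LG → IsPermTableau m EF LF
  insert {m} pt = record { column-has-one = columns ; zero-rule = zeros }
    where
    open IsPermTableau pt
    columns : ∀ j → j < m → ∃[ i ] EF i j ≡ true
    columns j j<m with i , one ← column-has-one j j<m = skip i₀ i , trans (sym (EG≡ i j)) one
    zeros : ∀ i j → j < LF i → EF i j ≡ false → ZerosAboveOrLeft EF i j
    zeros i j j<ℓ e with i ≟ i₀
    ... | yes refl = inj₂ (λ j′ _ → zero-row j′)
    ... | no i≢i₀ with k , refl ← skip-onto i₀ i i≢i₀
                  with zero-rule k j (subst (j <_) (sym (LG≡ k)) j<ℓ) (trans (EG≡ k j) e)
    ...   | inj₂ clear-left = inj₂ λ j′ j′<j → trans (sym (EG≡ k j′)) (clear-left j′ j′<j)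
    ...   | inj₁ clear-above = inj₁ clear
      where
      clear : ∀ i′ → i′ < skip i₀ k → EF i′ j ≡ false
      clear i′ i′<i with i′ ≟ i₀
      ... | yes refl = zero-row j
      ... | no i′≢i₀ with k′ , refl ← skip-onto i₀ i′ i′≢i₀ =
        trans (sym (EG≡ k′ j)) (clear-above k′ (skip-cancel-< i₀ i′<i))

module DeleteColumn (a : ℕ) {EF EG : ℕ → ℕ → Bool} {LF LG : ℕ → ℕ}
  (EG≡ : ∀ i j → EG i j ≡ EF i (skip a j))
  (LG⇒ : ∀ i j → j < LG i → skip a j < LF i) (⇒LG : ∀ i j → skip a j < LF i → j < LG i) where

  delete : ∀ {m} → IsPermTableau (suc m) EF LF → IsPermTableau m EG LG
  delete {m} pt = record { column-has-one = columns ; zero-rule = zeros }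
    where
    open IsPermTableau pt
    columns : ∀ j → j < m → ∃[ i ] EG i j ≡ true
    columns j j<m with i , one ← column-has-one (skip a j) (≤-<-trans (skip≤suc a j) (s≤s j<m)) =
      i , trans (EG≡ i j) one
    zeros : ∀ i j → j < LG i → EG i j ≡ false → ZerosAboveOrLeft EG i j
    zeros i j j<ℓ e = Sum.map
      (λ clear-above i′ i′<i → trans (EG≡ i′ j) (clear-above i′ i′<i))
      (λ clear-left j′ j′<j → trans (EG≡ i j′) (clear-left _ (skip-mono-< a j′<j)))
      (zero-rule i (skip a j) (LG⇒ i j j<ℓ) (trans (sym (EG≡ i j)) e))

  insert : ∀ {m i₀} → a ≤ m → Corner LF i₀ a → EF i₀ a ≡ true → (∀ i → i ≢ i₀ → EF i a ≡ false) →
    IsPermTableau m EG LG → IsPermTableau (suc m) EF LF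
  insert {m} {i₀} a≤m corner one only-one pt = record { column-has-one = columns ; zero-rule = zeros }
    where
    open IsPermTableau pt
    columns : ∀ j → j < suc m → ∃[ i ] EF i j ≡ true
    columns j j<m with j ≟ a
    ... | yes refl = i₀ , one
    ... | no j≢a with j′ , refl ← skip-onto a j j≢a
                 with i , one′ ← column-has-one j′ (skip-bound j′ a≤m j<m) =
      i , trans (sym (EG≡ i j′)) one′
    zeros : ∀ i j → j < LF i → EF i j ≡ false → ZerosAboveOrLeft EF i j
    zeros i j j<ℓ e with j ≟ a
    ... | yes refl = inj₁ λ i′ i′<i → only-one i′ λ { refl →
                       <-irrefl refl (<-≤-trans i′<i (Corner.long-row⇒above corner j<ℓ)) }
    ... | no j≢a with j′ , refl ← skip-onto a j j≢a
                 with zero-rule i j′ (⇒LG i j′ j<ℓ) (trans (EG≡ i j′) e)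
    ...   | inj₁ clear-above = inj₁ λ i′ i′<i → trans (sym (EG≡ i′ j′)) (clear-above i′ i′<i)
    ...   | inj₂ clear-left = inj₂ clear
      where
      clear : ∀ j″ → j″ < skip a j′ → EF i j″ ≡ false
      clear j″ j″<j with j″ ≟ a
      ... | yes refl = only-one i λ { refl → <-irrefl refl (≤-<-trans
              (≤-pred (subst (skip a j′ <_) (Corner.corner-row corner) j<ℓ)) j″<j) }
      ... | no j″≢a with k , refl ← skip-onto a j″ j″≢a =
        trans (sym (EG≡ i k)) (clear-left k (skip-cancel-< a j″<j))

module DeleteCornerCell {m i₀ a : ℕ} {EF EG : ℕ → ℕ → Bool} {LF LG : ℕ → ℕ}
  (a<m : a < m) (corner : Corner LF i₀ a) (boundedG : Bounded EG LG)
  (one : EF i₀ a ≡ true) (LG-corner : LG i₀ ≡ a)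
  (agree : ∀ i j → (i ≡ i₀ → j ≢ a) → EF i j ≡ EG i j)
  (L-agree : ∀ i → i ≢ i₀ → LF i ≡ LG i) where

  OneAbove : Set
  OneAbove = ∃[ i ] i < i₀ × EF i a ≡ true

  private
    open Corner corner

    a≮LG : a < LG i₀ → ⊥
    a≮LG = <-irrefl (sym LG-corner)

    a≮LF-below : ∀ {i} → i₀ < i → a < LF i → ⊥
    a≮LF-below i₀<i a<ℓ = <⇒≱ i₀<i (long-row⇒above a<ℓ)

    zero-at-corner : EG i₀ a ≡ false
    zero-at-corner with EG i₀ a in e
    ... | false = refl
    ... | true  = ⊥-elim (a≮LG (boundedG i₀ a e))

    EF-false⇒EG-false : ∀ {i j} → EF i j ≡ false → EG i j ≡ false
    EF-false⇒EG-false {i} {j} e with i ≟ i₀ | j ≟ a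
    ... | yes refl | yes refl = zero-at-corner
    ... | yes refl | no j≢a  = trans (sym (agree i j (λ _ → j≢a))) e
    ... | no i≢i₀  | _       = trans (sym (agree i j (⊥-elim ∘ i≢i₀))) e

    EG-true⇒EF-true : ∀ {i j} → EG i j ≡ true → EF i j ≡ true
    EG-true⇒EF-true {i} {j} e with i ≟ i₀ | j ≟ a
    ... | yes refl | yes refl = one
    ... | yes refl | no j≢a  = trans (agree i j (λ _ → j≢a)) e
    ... | no i≢i₀  | _       = trans (agree i j (⊥-elim ∘ i≢i₀)) e

  delete : IsPermTableau m EF LF → OneAbove → IsPermTableau m EG LG
  delete pt (iu , iu<i₀ , one-above) = record { column-has-one = columns ; zero-rule = zeros }
    where
    open IsPermTableau pt
    columns : ∀ j → j < m → ∃[ i ] EG i j ≡ true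
    columns j j<m with i , e ← column-has-one j j<m with i ≟ i₀ | j ≟ a
    ... | yes refl | yes refl = iu , trans (sym (agree iu a λ { refl → ⊥-elim (<-irrefl refl iu<i₀) })) one-above
    ... | yes refl | no j≢a  = i , trans (sym (agree i j (λ _ → j≢a))) e
    ... | no i≢i₀  | _       = i , trans (sym (agree i j (⊥-elim ∘ i≢i₀))) e
    zeros : ∀ i j → j < LG i → EG i j ≡ false → ZerosAboveOrLeft EG i j
    zeros i j j<ℓ e = Sum.map (λ clear i′ lt → EF-false⇒EG-false (clear i′ lt))
                              (λ clear j′ lt → EF-false⇒EG-false (clear j′ lt))
                              (zero-rule i j j<LF (trans (agree i j λ { refl refl → a≮LG j<ℓ }) e))
      where
      j<LF : j < LF i
      j<LF with i ≟ i₀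
      ... | yes refl = subst (j <_) (sym corner-row) (m≤n⇒m≤1+n (subst (j <_) LG-corner j<ℓ))
      ... | no i≢i₀  = subst (j <_) (sym (L-agree i i≢i₀)) j<ℓ

  insert : IsPermTableau m EG LG → IsPermTableau m EF LF × OneAbove
  insert pt = record { column-has-one = columns ; zero-rule = zeros } , one-above
    where
    open IsPermTableau pt
    one-above : OneAbove
    one-above with i , e ← column-has-one a a<m with <-cmp i i₀
    ... | tri< i<i₀ _ _ = i , i<i₀ , EG-true⇒EF-true e
    ... | tri≈ _ refl _ = ⊥-elim (true≢false (trans (sym e) zero-at-corner))
    ... | tri> _ _ i₀<i = ⊥-elim (a≮LF-below i₀<i (subst (a <_) (sym (L-agree i (>⇒≢ i₀<i))) (boundedG i a e)))
    columns : ∀ j → j < m → ∃[ i ] EF i j ≡ true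
    columns j j<m with i , e ← column-has-one j j<m = i , EG-true⇒EF-true e
    zeros : ∀ i j → j < LF i → EF i j ≡ false → ZerosAboveOrLeft EF i j
    zeros i j j<ℓ e with zero-rule i j j<LG (trans (sym (agree i j off-corner)) e)
      where
      off-corner : i ≡ i₀ → j ≢ a
      off-corner refl refl = true≢false (trans (sym one) e)
      j<LG : j < LG i
      j<LG with i ≟ i₀
      ... | yes refl = subst (j <_) (sym LG-corner)
                         (≤∧≢⇒< (≤-pred (subst (j <_) corner-row j<ℓ)) (off-corner refl))
      ... | no i≢i₀  = subst (j <_) (L-agree i i≢i₀) j<ℓ
    ... | inj₁ clear = inj₁ λ i′ i′<i → trans (agree i′ j λ { refl refl → a≮LF-below i′<i j<ℓ }) (clear i′ i′<i)
    ... | inj₂ clear = inj₂ λ j′ j′<j → trans (agree i j′ λ { refl refl →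
                         <-irrefl refl (<-≤-trans j′<j (≤-pred (subst (j <_) corner-row j<ℓ))) }) (clear j′ j′<j)

deleteAt : ℕ → List Bool → List Bool
deleteAt a [] = []
deleteAt zero (x ∷ r) = r
deleteAt (suc a) (x ∷ r) = x ∷ deleteAt a r

insertAt : ℕ → Bool → List Bool → List Bool
insertAt zero x r = x ∷ r
insertAt (suc a) x [] = x ∷ []
insertAt (suc a) x (y ∷ r) = y ∷ insertAt a x r

getB-beyond : ∀ r {j} → length r ≤ j → getB r j ≡ false
getB-beyond [] _ = refl
getB-beyond (x ∷ r) (s≤s le) = getB-beyond r le

getB-deleteAt : ∀ a r j → getB (deleteAt a r) j ≡ getB r (skip a j)
getB-deleteAt a [] j = refl
getB-deleteAt zero (x ∷ r) j = refl
getB-deleteAt (suc a) (x ∷ r) zero = refl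
getB-deleteAt (suc a) (x ∷ r) (suc j) = getB-deleteAt a r j

getB-deleteAt-last : ∀ a r j → length r ≡ suc a → j ≢ a → getB (deleteAt a r) j ≡ getB r j
getB-deleteAt-last a r j ℓ j≢a with <-cmp j a
... | tri< j<a _ _ = trans (getB-deleteAt a r j) (cong (getB r) (skip-below j<a))
... | tri≈ _ j≡a _ = ⊥-elim (j≢a j≡a)
... | tri> _ _ a<j = trans (getB-deleteAt a r j)
    (trans (cong (getB r) (skip-above (<⇒≤ a<j)))
      (trans (getB-beyond r (subst (_≤ suc j) (sym ℓ) (m≤n⇒m≤1+n a<j)))
        (sym (getB-beyond r (subst (_≤ j) (sym ℓ) a<j)))))

<-length-deleteAt⁻ : ∀ a r j → j < length (deleteAt a r) → skip a j < length r
<-length-deleteAt⁻ zero (x ∷ r) j lt = s≤s lt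
<-length-deleteAt⁻ (suc a) (x ∷ r) zero _ = s≤s z≤n
<-length-deleteAt⁻ (suc a) (x ∷ r) (suc j) (s≤s lt) = s≤s (<-length-deleteAt⁻ a r j lt)

<-length-deleteAt⁺ : ∀ a r j → skip a j < length r → j < length (deleteAt a r)
<-length-deleteAt⁺ zero (x ∷ r) j (s≤s lt) = lt
<-length-deleteAt⁺ (suc a) (x ∷ r) zero _ = s≤s z≤n
<-length-deleteAt⁺ (suc a) (x ∷ r) (suc j) (s≤s lt) = s≤s (<-length-deleteAt⁺ a r j lt)

length-deleteAt : ∀ a r → a < length r → suc (length (deleteAt a r)) ≡ length r
length-deleteAt zero (x ∷ r) _ = refl
length-deleteAt (suc a) (x ∷ r) (s≤s lt) = cong suc (length-deleteAt a r lt)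

deleteAt-beyond : ∀ a r → length r ≤ a → deleteAt a r ≡ r
deleteAt-beyond a [] _ = refl
deleteAt-beyond (suc a) (x ∷ r) (s≤s le) = cong (x ∷_) (deleteAt-beyond a r le)

length-insertAt : ∀ a x r → a ≤ length r → length (insertAt a x r) ≡ suc (length r)
length-insertAt zero x r _ = refl
length-insertAt (suc a) x (y ∷ r) (s≤s le) = cong suc (length-insertAt a x r le)

getB-insertAt : ∀ a x r → a ≤ length r → getB (insertAt a x r) a ≡ x
getB-insertAt zero x r _ = refl
getB-insertAt (suc a) x (y ∷ r) (s≤s le) = getB-insertAt a x r le

deleteAt-insertAt : ∀ a x r → a ≤ length r → deleteAt a (insertAt a x r) ≡ r
deleteAt-insertAt zero x r _ = refl
deleteAt-insertAt (suc a) x (y ∷ r) (s≤s le) = cong (y ∷_) (deleteAt-insertAt a x r le)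

insertAt-deleteAt : ∀ a r → a < length r → insertAt a (getB r a) (deleteAt a r) ≡ r
insertAt-deleteAt zero (x ∷ r) _ = refl
insertAt-deleteAt (suc a) (x ∷ r) (s≤s lt) = cong (x ∷_) (insertAt-deleteAt a r lt)

ones-deleteAt-one : ∀ a r → getB r a ≡ true → ones r ≡ suc (ones (deleteAt a r))
ones-deleteAt-one zero (true ∷ r) _ = refl
ones-deleteAt-one (suc a) (true ∷ r) e = cong suc (ones-deleteAt-one a r e)
ones-deleteAt-one (suc a) (false ∷ r) e = ones-deleteAt-one a r e

ones-deleteAt-zero : ∀ a r → getB r a ≡ false → ones r ≡ ones (deleteAt a r)
ones-deleteAt-zero a [] _ = refl
ones-deleteAt-zero zero (false ∷ r) _ = refl
ones-deleteAt-zero (suc a) (true ∷ r) e = cong suc (ones-deleteAt-zero a r e)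
ones-deleteAt-zero (suc a) (false ∷ r) e = ones-deleteAt-zero a r e

deleteColumn : ℕ → Filling → Filling
deleteColumn a = map (deleteAt a)

padColumn : ℕ → Filling → Filling
padColumn a = map (insertAt a false)

updateRow : ℕ → (List Bool → List Bool) → Filling → Filling
updateRow i g [] = []
updateRow zero g (r ∷ F) = g r ∷ F
updateRow (suc i) g (r ∷ F) = r ∷ updateRow i g F

deleteRow : ℕ → Filling → Filling
deleteRow i [] = []
deleteRow zero (r ∷ F) = F
deleteRow (suc i) (r ∷ F) = r ∷ deleteRow i F

insertRow : ℕ → List Bool → Filling → Filling
insertRow zero z F = z ∷ F
insertRow (suc i) z [] = z ∷ []
insertRow (suc i) z (r ∷ F) = r ∷ insertRow i z F

insertColumn : ℕ → ℕ → Filling → Filling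
insertColumn i a [] = []
insertColumn zero a (r ∷ F) = insertAt a true r ∷ F
insertColumn (suc i) a (r ∷ F) = insertAt a false r ∷ insertColumn i a F

updateRow-++ : ∀ Fp g r Fq → updateRow (length Fp) g (Fp ++ r ∷ Fq) ≡ Fp ++ g r ∷ Fq
updateRow-++ [] g r Fq = refl
updateRow-++ (s ∷ Fp) g r Fq = cong (s ∷_) (updateRow-++ Fp g r Fq)

deleteRow-++ : ∀ Fp r Fq → deleteRow (length Fp) (Fp ++ r ∷ Fq) ≡ Fp ++ Fq
deleteRow-++ [] r Fq = refl
deleteRow-++ (s ∷ Fp) r Fq = cong (s ∷_) (deleteRow-++ Fp r Fq)

insertRow-++ : ∀ Fp z Fq → insertRow (length Fp) z (Fp ++ Fq) ≡ Fp ++ z ∷ Fq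
insertRow-++ [] z Fq = refl
insertRow-++ (s ∷ Fp) z Fq = cong (s ∷_) (insertRow-++ Fp z Fq)

insertColumn-++ : ∀ Fp a r Fq →
  insertColumn (length Fp) a (Fp ++ r ∷ Fq) ≡ padColumn a Fp ++ insertAt a true r ∷ Fq
insertColumn-++ [] a r Fq = refl
insertColumn-++ (s ∷ Fp) a r Fq = cong (insertAt a false s ∷_) (insertColumn-++ Fp a r Fq)

getRow-at : ∀ Fp r Fq → getRow (Fp ++ r ∷ Fq) (length Fp) ≡ r
getRow-at [] r Fq = refl
getRow-at (s ∷ Fp) r Fq = getRow-at Fp r Fq

getRow-other : ∀ Fp r r′ Fq i → i ≢ length Fp → getRow (Fp ++ r ∷ Fq) i ≡ getRow (Fp ++ r′ ∷ Fq) i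
getRow-other [] r r′ Fq zero i≢ = ⊥-elim (i≢ refl)
getRow-other [] r r′ Fq (suc i) _ = refl
getRow-other (s ∷ Fp) r r′ Fq zero _ = refl
getRow-other (s ∷ Fp) r r′ Fq (suc i) i≢ = getRow-other Fp r r′ Fq i (i≢ ∘ cong suc)

getRow-skip : ∀ Fp r Fq i → getRow (Fp ++ Fq) i ≡ getRow (Fp ++ r ∷ Fq) (skip (length Fp) i)
getRow-skip [] r Fq i = refl
getRow-skip (s ∷ Fp) r Fq zero = refl
getRow-skip (s ∷ Fp) r Fq (suc i) = getRow-skip Fp r Fq i

getRow-prefix : ∀ Fp G i → i < length Fp → getRow (Fp ++ G) i ≡ getRow Fp i
getRow-prefix (s ∷ Fp) G zero _ = refl
getRow-prefix (s ∷ Fp) G (suc i) (s≤s lt) = getRow-prefix Fp G i lt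

getRow-map : ∀ g → g [] ≡ [] → ∀ F i → getRow (map g F) i ≡ g (getRow F i)
getRow-map g g[] [] i = sym g[]
getRow-map g g[] (r ∷ F) zero = refl
getRow-map g g[] (r ∷ F) (suc i) = getRow-map g g[] F i

HasShape-++⁻ : ∀ P {Q F} → HasShape (P ++ Q) F →
  ∃[ Fp ] ∃[ Fq ] F ≡ Fp ++ Fq × HasShape P Fp × HasShape Q Fq
HasShape-++⁻ [] hs = [] , _ , refl , [] , hs
HasShape-++⁻ (c ∷ P) (ℓ ∷ hs) with Fp , Fq , refl , hp , hq ← HasShape-++⁻ P hs =
  _ ∷ Fp , Fq , refl , ℓ ∷ hp , hq

HasShape-++-∷⁻ : ∀ P {c Q F} → HasShape (P ++ c ∷ Q) F →
  ∃[ Fp ] ∃[ r ] ∃[ Fq ] F ≡ Fp ++ r ∷ Fq × HasShape P Fp × length r ≡ c × HasShape Q Fq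
HasShape-++-∷⁻ P hs with Fp , _ , refl , hp , ℓ ∷ hq ← HasShape-++⁻ P hs = Fp , _ , _ , refl , hp , ℓ , hq

getRow-beyond : ∀ Fp r Fq i → length Fp < i → getRow (Fp ++ r ∷ Fq) i ≡ getRow Fq (i ∸ suc (length Fp))
getRow-beyond [] r Fq (suc i) _ = refl
getRow-beyond (s ∷ Fp) r Fq (suc i) (s≤s lt) = getRow-beyond Fp r Fq i lt

part-bounded : ∀ {a} Q → All (_≤ a) Q → ∀ k → part Q k ≤ a
part-bounded [] _ k = z≤n
part-bounded (c ∷ Q) (c≤a ∷ _) zero = c≤a
part-bounded (c ∷ Q) (_ ∷ Q≤a) (suc k) = part-bounded Q Q≤a k

corner-of-filling : ∀ {a Q} Fp r {Fq} → length r ≡ suc a → HasShape Q Fq → All (_≤ a) Q →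
  Corner (rowLength (Fp ++ r ∷ Fq)) (length Fp) a
corner-of-filling {a} {Q} Fp r {Fq} ℓ hq Q≤a = record
  { corner-row = trans (cong length (getRow-at Fp r Fq)) ℓ
  ; rows-below = λ i lt → subst (_≤ a)
      (sym (trans (cong length (getRow-beyond Fp r Fq i lt)) (rowLength-shape hq _)))
      (part-bounded Q Q≤a _) }

bounded : ∀ F → Bounded (entry F) (rowLength F)
bounded F i j = getB-true⇒< (getRow F i) j

countOnes-++ : ∀ F G → countOnes (F ++ G) ≡ countOnes F + countOnes G
countOnes-++ [] G = refl
countOnes-++ (r ∷ F) G = trans (cong (ones r +_) (countOnes-++ F G)) (sym (+-assoc (ones r) _ _))

countOnes-row : ∀ Fp r Fq → countOnes (Fp ++ r ∷ Fq) ≡ ones r + countOnes (Fp ++ Fq)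
countOnes-row Fp r Fq = begin
  countOnes (Fp ++ r ∷ Fq)               ≡⟨ countOnes-++ Fp (r ∷ Fq) ⟩
  countOnes Fp + (ones r + countOnes Fq) ≡⟨ x∙yz≈y∙xz (countOnes Fp) (ones r) (countOnes Fq) ⟩
  ones r + (countOnes Fp + countOnes Fq) ≡⟨ cong (ones r +_) (sym (countOnes-++ Fp Fq)) ⟩
  ones r + countOnes (Fp ++ Fq)          ∎
  where open ≡-Reasoning

countOnes-deleteColumn : ∀ a F →
  countOnes F ≡ count (λ r → getB r a) F + countOnes (deleteColumn a F)
countOnes-deleteColumn a [] = refl
countOnes-deleteColumn a (r ∷ F) with getB r a in e
... | true  = trans (cong₂ _+_ (ones-deleteAt-one a r e) (countOnes-deleteColumn a F))
                (interchange 1 (ones (deleteAt a r)) (count (λ r → getB r a) F) (countOnes (map (deleteAt a) F)))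
... | false = trans (cong₂ _+_ (ones-deleteAt-zero a r e) (countOnes-deleteColumn a F))
                (interchange 0 (ones (deleteAt a r)) (count (λ r → getB r a) F) (countOnes (map (deleteAt a) F)))

column-count-zero : ∀ a F → (∀ i → entry F i a ≡ false) → count (λ r → getB r a) F ≡ 0
column-count-zero a [] _ = refl
column-count-zero a (r ∷ F) zero-col rewrite zero-col 0 = column-count-zero a F (zero-col ∘ suc)

column-count-one : ∀ a F i₀ → entry F i₀ a ≡ true → (∀ i → i ≢ i₀ → entry F i a ≡ false) →
  count (λ r → getB r a) F ≡ 1
column-count-one a (r ∷ F) zero one others rewrite one =
  cong suc (column-count-zero a F (λ i → others (suc i) λ ()))
column-count-one a (r ∷ F) (suc i₀) one others rewrite others 0 (λ ()) =
  column-count-one a F i₀ one (λ i i≢ → others (suc i) (i≢ ∘ suc-injective))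

deleteColumn-shape : ∀ {a P Fp} → All (suc a ≤_) P → HasShape P Fp → HasShape (map pred P) (deleteColumn a Fp)
deleteColumn-shape [] [] = []
deleteColumn-shape {a} (a<c ∷ P-long) (_∷_ {y = r} refl hs) =
  cong pred (length-deleteAt a r a<c) ∷ deleteColumn-shape P-long hs

padColumn-shape : ∀ {a P Gp} → All (suc a ≤_) P → HasShape (map pred P) Gp → HasShape P (padColumn a Gp)
padColumn-shape {P = []} [] [] = []
padColumn-shape {a} {suc c ∷ P} (s≤s a≤c ∷ P-long) (_∷_ {y = s} refl hs) =
  length-insertAt a false s a≤c ∷ padColumn-shape P-long hs

deleteColumn-short : ∀ {a Q Fq} → All (_≤ a) Q → HasShape Q Fq → deleteColumn a Fq ≡ Fq
deleteColumn-short [] [] = refl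
deleteColumn-short {a} (c≤a ∷ Q-short) (_∷_ {y = r} refl hs) =
  cong₂ _∷_ (deleteAt-beyond a r c≤a) (deleteColumn-short Q-short hs)

deleteColumn-padColumn : ∀ {a P Gp} → All (suc a ≤_) P → HasShape (map pred P) Gp →
  deleteColumn a (padColumn a Gp) ≡ Gp
deleteColumn-padColumn {P = []} [] [] = refl
deleteColumn-padColumn {a} {suc c ∷ P} (s≤s a≤c ∷ P-long) (_∷_ {y = s} refl hs) =
  cong₂ _∷_ (deleteAt-insertAt a false s a≤c) (deleteColumn-padColumn P-long hs)

padColumn-deleteColumn : ∀ {a P Fp} → All (suc a ≤_) P → HasShape P Fp →
  (∀ i → i < length Fp → entry Fp i a ≡ false) → padColumn a (deleteColumn a Fp) ≡ Fp
padColumn-deleteColumn [] [] _ = refl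
padColumn-deleteColumn {a} (a<c ∷ P-long) (_∷_ {y = r} refl hs) clear = cong₂ _∷_
  (subst (λ b → insertAt a b (deleteAt a r) ≡ r) (clear 0 (s≤s z≤n)) (insertAt-deleteAt a r a<c))
  (padColumn-deleteColumn P-long hs (λ i lt → clear (suc i) (s≤s lt)))

padColumn-zero : ∀ {a P Gp} → All (suc a ≤_) P → HasShape (map pred P) Gp →
  ∀ i → i < length Gp → entry (padColumn a Gp) i a ≡ false
padColumn-zero {a} {suc c ∷ P} (s≤s a≤c ∷ _) (_∷_ {y = s} refl _) zero _ = getB-insertAt a false s a≤c
padColumn-zero {a} {suc c ∷ P} (_ ∷ P-long) (_ ∷ hs) (suc i) (s≤s lt) = padColumn-zero P-long hs i lt

getB-replicate-false : ∀ n j → getB (replicate n false) j ≡ false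
getB-replicate-false zero j = refl
getB-replicate-false (suc n) zero = refl
getB-replicate-false (suc n) (suc j) = getB-replicate-false n j

zero-row⇒replicate : ∀ r → (∀ j → getB r j ≡ false) → r ≡ replicate (length r) false
zero-row⇒replicate [] _ = refl
zero-row⇒replicate (x ∷ r) zeros = cong₂ _∷_ (zeros 0) (zero-row⇒replicate r (zeros ∘ suc))

ones-replicate-false : ∀ n → ones (replicate n false) ≡ 0
ones-replicate-false zero = refl
ones-replicate-false (suc n) = ones-replicate-false n

-- The corner recursion

isTableauOfWeight : List ℕ → ℕ → Filling → Bool
isTableauOfWeight sh d F = isPermTableau sh F ∧ (wt sh F ≡ᵇ d)

numTableaux : List ℕ → ℕ → ℕ
numTableaux sh d = length (filterᵇ (λ T → wt sh T ≡ᵇ d) (permTableaux sh))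

numTableaux-count : ∀ sh d → numTableaux sh d ≡ count (isTableauOfWeight sh d) (allFillings sh)
numTableaux-count sh d = length-filterᵇ-filterᵇ (isPermTableau sh) (λ T → wt sh T ≡ᵇ d) (allFillings sh)

T-isTableauOfWeight : ∀ sh d F → T (isTableauOfWeight sh d F) ⇔ (T (isPermTableau sh F) × wt sh F ≡ d)
T-isTableauOfWeight sh d F = mk⇔ (λ t → let (pt , w) = to T-∧ t in pt , ≡ᵇ⇒≡ _ _ w)
                          (λ (pt , w) → from T-∧ (pt , ≡⇒≡ᵇ _ _ w))

record MapsInto (sh : List ℕ) (q : Filling → Bool) (φ ψ : Filling → Filling) (F : Filling) : Set where
  constructor mapsInto
  field
    image-shape : HasShape sh (φ F)
    image-holds : T (q (φ F))
    returns     : ψ (φ F) ≡ F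

MapsInto-via : ∀ {sh q φ ψ F G} → φ F ≡ G → HasShape sh G → T (q G) → ψ G ≡ F → MapsInto sh q φ ψ F
MapsInto-via refl = mapsInto

count-fillings-by-bijection : ∀ {sh sh′} (p q : Filling → Bool) (φ ψ : Filling → Filling) →
  (∀ {F} → HasShape sh F → T (p F) → MapsInto sh′ q φ ψ F) →
  (∀ {G} → HasShape sh′ G → T (q G) → MapsInto sh p ψ φ G) →
  count p (allFillings sh) ≡ count q (allFillings sh′)
count-fillings-by-bijection {sh} {sh′} p q φ ψ into onto =
  count-≡-by-bijection p q φ ψ (allFillings-unique sh) (allFillings-unique sh′)
    (λ F∈ pF → let mapsInto hG qG ψφ = into (allFillings-sound sh F∈) pF in allFillings-complete hG , qG , ψφ)
    (λ G∈ qG → let mapsInto hF pF φψ = onto (allFillings-sound sh′ G∈) qG in allFillings-complete hF , pF , φψ)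

timesQ : (ℕ → ℕ) → ℕ → ℕ
timesQ f zero = 0
timesQ f (suc d) = f d

module ZeroRowDeletion {p : ℕ} {Ps : List ℕ} {c : ℕ} {Q : List ℕ} {Fp : Filling} (r : List Bool) {Fq : Filling}
  (hp : HasShape (p ∷ Ps) Fp) (ℓ : length r ≡ c) (hq : HasShape Q Fq) (zeros : ∀ j → getB r j ≡ false) where

  F G : Filling
  F = Fp ++ r ∷ Fq
  G = Fp ++ Fq

  hF : HasShape ((p ∷ Ps) ++ c ∷ Q) F
  hF = hp ++ₚ (ℓ ∷ hq)

  hG : HasShape ((p ∷ Ps) ++ Q) G
  hG = hp ++ₚ hq

  open DeleteRow (length Fp) {entry F} {entry G} {rowLength F} {rowLength G}
    (λ i j → cong (λ x → getB x j) (getRow-skip Fp r Fq i)) (λ i → cong length (getRow-skip Fp r Fq i))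
    (λ j → trans (cong (λ x → getB x j) (getRow-at Fp r Fq)) (zeros j))

  PT⇔ : T (isPermTableau ((p ∷ Ps) ++ c ∷ Q) F) ⇔ T (isPermTableau ((p ∷ Ps) ++ Q) G)
  PT⇔ = mk⇔ (λ pt → from (isPermTableau⇔ hG) (delete (to (isPermTableau⇔ hF) pt)))
            (λ pt → from (isPermTableau⇔ hF) (insert (to (isPermTableau⇔ hG) pt)))

  r≡ : r ≡ replicate c false
  r≡ = trans (zero-row⇒replicate r zeros) (cong (λ n → replicate n false) ℓ)

  weight : wt ((p ∷ Ps) ++ c ∷ Q) F ≡ wt ((p ∷ Ps) ++ Q) G
  weight = cong (_∸ p) (trans (countOnes-row Fp r Fq)
    (cong (_+ countOnes G) (trans (cong ones r≡) (ones-replicate-false c))))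

  i₀≡ : length Fp ≡ length (p ∷ Ps)
  i₀≡ = sym (Pointwise-length hp)

  deleteRow-F : deleteRow (length (p ∷ Ps)) F ≡ G
  deleteRow-F = trans (cong (λ k → deleteRow k F) (sym i₀≡)) (deleteRow-++ Fp r Fq)

  insertRow-G : insertRow (length (p ∷ Ps)) (replicate c false) G ≡ F
  insertRow-G = trans (cong (λ k → insertRow k _ G) (sym i₀≡))
    (trans (insertRow-++ Fp _ Fq) (cong (λ x → Fp ++ x ∷ Fq) (sym r≡)))

numTableaux-empty-row : ∀ p Ps Q d → numTableaux ((p ∷ Ps) ++ 0 ∷ Q) d ≡ numTableaux ((p ∷ Ps) ++ Q) d
numTableaux-empty-row p Ps Q d = begin
  numTableaux ν d                          ≡⟨ numTableaux-count ν d ⟩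
  count (isTableauOfWeight ν d) (allFillings ν)
    ≡⟨ count-fillings-by-bijection _ _ (deleteRow (length P)) (insertRow (length P) []) into onto ⟩
  count (isTableauOfWeight ν′ d) (allFillings ν′) ≡⟨ sym (numTableaux-count ν′ d) ⟩
  numTableaux ν′ d                         ∎
  where
  open ≡-Reasoning
  P ν ν′ : List ℕ
  P = p ∷ Ps
  ν = P ++ 0 ∷ Q
  ν′ = P ++ Q
  into : ∀ {F} → HasShape ν F → T (isTableauOfWeight ν d F) →
    MapsInto ν′ (isTableauOfWeight ν′ d) (deleteRow (length P)) (insertRow (length P) []) F
  into hs t with Fp , [] , Fq , refl , hp , refl , hq ← HasShape-++-∷⁻ P hs =
    let open ZeroRowDeletion [] hp refl hq (λ _ → refl)
        (pt , w) = to (T-isTableauOfWeight ν d F) t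
    in MapsInto-via deleteRow-F hG (from (T-isTableauOfWeight ν′ d G) (to PT⇔ pt , trans (sym weight) w)) insertRow-G
  onto : ∀ {G} → HasShape ν′ G → T (isTableauOfWeight ν′ d G) →
    MapsInto ν (isTableauOfWeight ν d) (insertRow (length P) []) (deleteRow (length P)) G
  onto hs t with Fp , Fq , refl , hp , hq ← HasShape-++⁻ P hs =
    let open ZeroRowDeletion [] hp refl hq (λ _ → refl)
        (pt , w) = to (T-isTableauOfWeight ν′ d G) t
    in MapsInto-via insertRow-G hF (from (T-isTableauOfWeight ν d F) (from PT⇔ pt , trans weight w)) deleteRow-F

module CornerRecursion (p′ : ℕ) (Ps : List ℕ) (a : ℕ) (Q : List ℕ)
  (P-long : All (suc a ≤_) (suc p′ ∷ Ps)) (Q-short : All (_≤ a) Q) where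

  P : List ℕ
  P = suc p′ ∷ Ps

  i₀ : ℕ
  i₀ = length P

  ν ν∖cell ν∖row ν∖column : List ℕ
  ν        = P ++ suc a ∷ Q
  ν∖cell   = P ++ a ∷ Q
  ν∖row    = P ++ Q
  ν∖column = map pred P ++ a ∷ Q

  a<p : a < suc p′
  a<p = All.head P-long

  cornerEntry oneAbove : Filling → Bool
  cornerEntry F = entry F i₀ a
  oneAbove F = any (λ i → entry F i a) (upTo i₀)

  cellCase columnCase rowCase : ℕ → Filling → Bool
  cellCase d F   = (isTableauOfWeight ν d F ∧ cornerEntry F) ∧ oneAbove F
  columnCase d F = (isTableauOfWeight ν d F ∧ cornerEntry F) ∧ not (oneAbove F)
  rowCase d F    = isTableauOfWeight ν d F ∧ not (cornerEntry F)

  T-cornerOne : ∀ d F o → T ((isTableauOfWeight ν d F ∧ cornerEntry F) ∧ o) ⇔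
    ((T (isPermTableau ν F) × wt ν F ≡ d) × T (cornerEntry F) × T o)
  T-cornerOne d F o = mk⇔
    (λ t → let (tc , to′) = to (T-∧ {isTableauOfWeight ν d F ∧ cornerEntry F} {o}) t
               (tw , c)   = to (T-∧ {isTableauOfWeight ν d F} {cornerEntry F}) tc
           in to (T-isTableauOfWeight ν d F) tw , c , to′)
    (λ (ptw , c , to′) → from (T-∧ {isTableauOfWeight ν d F ∧ cornerEntry F} {o})
      (from (T-∧ {isTableauOfWeight ν d F} {cornerEntry F}) (from (T-isTableauOfWeight ν d F) ptw , c) , to′))

  removeCell restoreCell removeRow restoreRow removeColumn restoreColumn : Filling → Filling
  removeCell    = updateRow i₀ (deleteAt a)
  restoreCell   = updateRow i₀ (insertAt a true)
  removeRow     = deleteRow i₀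
  restoreRow    = insertRow i₀ (replicate (suc a) false)
  removeColumn  = deleteColumn a
  restoreColumn = insertColumn i₀ a

  insertAt-corner : ∀ {s} → length s ≡ a →
    length (insertAt a true s) ≡ suc a × getB (insertAt a true s) a ≡ true × deleteAt a (insertAt a true s) ≡ s
  insertAt-corner {s} ℓ = let a≤ℓ = ≤-reflexive (sym ℓ) in
    trans (length-insertAt a true s a≤ℓ) (cong suc ℓ) , getB-insertAt a true s a≤ℓ , deleteAt-insertAt a true s a≤ℓ

  module CornerRow {Fp : Filling} (r : List Bool) {Fq : Filling}
    (hp : HasShape P Fp) (ℓ : length r ≡ suc a) (hq : HasShape Q Fq) where

    F : Filling
    F = Fp ++ r ∷ Fq

    hF : HasShape ν F
    hF = hp ++ₚ (ℓ ∷ hq)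

    i₀≡ : length Fp ≡ i₀
    i₀≡ = sym (Pointwise-length hp)

    corner : Corner (rowLength F) (length Fp) a
    corner = corner-of-filling Fp r ℓ hq Q-short

    PT⇔ : T (isPermTableau ν F) ⇔ IsPermTableau (suc p′) (entry F) (rowLength F)
    PT⇔ = isPermTableau⇔ hF

    entry-corner : entry F (length Fp) a ≡ getB r a
    entry-corner = cong (λ x → getB x a) (getRow-at Fp r Fq)

    cornerEntry≡ : cornerEntry F ≡ getB r a
    cornerEntry≡ = trans (cong (λ k → entry F k a) (sym i₀≡)) entry-corner

    oneAbove⇔ : T (oneAbove F) ⇔ (∃[ i ] i < length Fp × entry F i a ≡ true)
    oneAbove⇔ = mk⇔
      (λ t → let (i , i∈ , e) = find (any⁻ _ (upTo i₀) t) in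
             i , subst (i <_) (sym i₀≡) (∈-upTo⁻ i∈) , to T-≡ e)
      (λ (i , i<i₀ , e) → any-upTo⁺ _ i₀ (subst (i <_) i₀≡ i<i₀) (from T-≡ e))

    corner-one : ∀ d o → T ((isTableauOfWeight ν d F ∧ cornerEntry F) ∧ o) → getB r a ≡ true
    corner-one d o t = trans (sym cornerEntry≡) (to T-≡ (proj₁ (proj₂ (to (T-cornerOne d F o) t))))

    zeros-above⇔ : oneAbove F ≡ false ⇔ (∀ i → i < length Fp → entry Fp i a ≡ false)
    zeros-above⇔ = mk⇔
      (λ none i i< → trans (cong (λ x → getB x a) (sym (getRow-prefix Fp (r ∷ Fq) i i<)))
                       (any-upTo-false⁻ _ i₀ none i (subst (i <_) i₀≡ i<)))
      (λ clear → any-upTo-false⁺ _ i₀ λ i lt → let i< = subst (i <_) (sym i₀≡) lt in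
                   trans (cong (λ x → getB x a) (getRow-prefix Fp (r ∷ Fq) i i<)) (clear i i<))

    zero-corner⇒zero-r : T (isPermTableau ν F) → getB r a ≡ false → ∀ j → getB r j ≡ false
    zero-corner⇒zero-r pt corner-zero j = trans (cong (λ x → getB x j) (sym (getRow-at Fp r Fq)))
      (zero-corner⇒zero-row (to PT⇔ pt) (bounded F) corner a<p (trans entry-corner corner-zero) j)

    a<ℓ : a < length r
    a<ℓ = subst (a <_) (sym ℓ) ≤-refl

    r′ : List Bool
    r′ = deleteAt a r

    ℓ′ : length r′ ≡ a
    ℓ′ = suc-injective (trans (length-deleteAt a r a<ℓ) ℓ)

    reinsert : getB r a ≡ true → insertAt a true r′ ≡ r
    reinsert one = subst (λ b → insertAt a b r′ ≡ r) one (insertAt-deleteAt a r a<ℓ)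

    module CellDeletion (one : getB r a ≡ true) where

      G : Filling
      G = Fp ++ r′ ∷ Fq

      hG : HasShape ν∖cell G
      hG = hp ++ₚ (ℓ′ ∷ hq)

      agree : ∀ i j → (i ≡ length Fp → j ≢ a) → entry F i j ≡ entry G i j
      agree i j off with i ≟ length Fp
      ... | yes refl = trans (cong (λ x → getB x j) (getRow-at Fp r Fq))
                         (trans (sym (getB-deleteAt-last a r j ℓ (off refl)))
                           (cong (λ x → getB x j) (sym (getRow-at Fp r′ Fq))))
      ... | no i≢ = cong (λ x → getB x j) (getRow-other Fp r r′ Fq i i≢)

      open DeleteCornerCell a<p corner (bounded G) (trans entry-corner one)
        (trans (cong length (getRow-at Fp r′ Fq)) ℓ′) agree
        (λ i i≢ → cong length (getRow-other Fp r r′ Fq i i≢))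

      ones-removed : countOnes F ≡ suc (countOnes G)
      ones-removed = trans (countOnes-row Fp r Fq)
        (trans (cong (_+ countOnes (Fp ++ Fq)) (ones-deleteAt-one a r one)) (cong suc (sym (countOnes-row Fp r′ Fq))))

      -- wt subtracts truncatedly; it is exact because G has a 1 in each of its columns.
      weight : T (isPermTableau ν∖cell G) → wt ν F ≡ suc (wt ν∖cell G)
      weight pt = trans (cong (_∸ suc p′) ones-removed)
        (+-∸-assoc 1 (columns≤countOnes (suc p′) G (IsPermTableau.column-has-one (to (isPermTableau⇔ hG) pt))))

      removeCell-F : removeCell F ≡ G
      removeCell-F = trans (cong (λ k → updateRow k (deleteAt a) F) (sym i₀≡)) (updateRow-++ Fp (deleteAt a) r Fq)

      restoreCell-G : restoreCell G ≡ F
      restoreCell-G = trans (cong (λ k → updateRow k (insertAt a true) G) (sym i₀≡))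
        (trans (updateRow-++ Fp (insertAt a true) r′ Fq) (cong (λ x → Fp ++ x ∷ Fq) (reinsert one)))

      deletable : ∀ {d} → T (cellCase d F) → T (isPermTableau ν∖cell G) × wt ν F ≡ d
      deletable {d} t = let ((pt , w) , _ , above) = to (T-cornerOne d F (oneAbove F)) t
                        in from (isPermTableau⇔ hG) (delete (to PT⇔ pt) (to oneAbove⇔ above)) , w

      weight-positive : ¬ T (cellCase 0 F)
      weight-positive t = let (ptG , w) = deletable t in 0≢1+n (trans (sym w) (weight ptG))

      forward : ∀ {d} → T (cellCase (suc d) F) →
        MapsInto ν∖cell (isTableauOfWeight ν∖cell d) removeCell restoreCell F
      forward {d} t =
        let (ptG , w) = deletable t
        in MapsInto-via removeCell-F hG
             (from (T-isTableauOfWeight ν∖cell d G) (ptG , suc-injective (trans (sym (weight ptG)) w)))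
             restoreCell-G

      backward : ∀ {d} → T (isTableauOfWeight ν∖cell d G) →
        MapsInto ν (cellCase (suc d)) restoreCell removeCell G
      backward {d} t =
        let (ptG , w) = to (T-isTableauOfWeight ν∖cell d G) t
            (pt , above) = insert (to (isPermTableau⇔ hG) ptG)
        in MapsInto-via restoreCell-G hF (from (T-cornerOne (suc d) F (oneAbove F))
                         ((from PT⇔ pt , trans (weight ptG) (cong suc w)) , from T-≡ (trans cornerEntry≡ one) ,
                          from oneAbove⇔ above))
                    removeCell-F

    module ColumnDeletion (one : getB r a ≡ true) (clear : ∀ i → i < length Fp → entry Fp i a ≡ false) where

      G : Filling
      G = deleteColumn a F

      G≡ : G ≡ deleteColumn a Fp ++ r′ ∷ Fq
      G≡ = trans (map-++ (deleteAt a) Fp (r ∷ Fq)) (cong (λ X → deleteColumn a Fp ++ r′ ∷ X) (deleteColumn-short Q-short hq))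

      hG : HasShape ν∖column G
      hG = subst (HasShape ν∖column) (sym G≡) (deleteColumn-shape P-long hp ++ₚ (ℓ′ ∷ hq))

      only-one : ∀ i → i ≢ length Fp → entry F i a ≡ false
      only-one i i≢ with entry F i a in e
      ... | false = refl
      ... | true = ⊥-elim (true≢false (trans (sym e) (trans (cong (λ x → getB x a) (getRow-prefix Fp (r ∷ Fq) i i<))
                                                          (clear i i<))))
        where
        i< : i < length Fp
        i< = ≤∧≢⇒< (corner-column (bounded F) corner i e) i≢

      rowG : ∀ i → getRow G i ≡ deleteAt a (getRow F i)
      rowG = getRow-map (deleteAt a) refl F

      open DeleteColumn a {entry F} {entry G} {rowLength F} {rowLength G}
        (λ i j → trans (cong (λ x → getB x j) (rowG i)) (getB-deleteAt a (getRow F i) j))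
        (λ i j lt → <-length-deleteAt⁻ a (getRow F i) j (subst (j <_) (cong length (rowG i)) lt))
        (λ i j lt → subst (j <_) (cong length (sym (rowG i))) (<-length-deleteAt⁺ a (getRow F i) j lt))

      weight : wt ν F ≡ wt ν∖column G
      weight = cong (_∸ suc p′) (trans (countOnes-deleteColumn a F)
        (cong (_+ countOnes G) (column-count-one a F (length Fp) (trans entry-corner one) only-one)))

      restoreColumn-G : restoreColumn G ≡ F
      restoreColumn-G = begin
        insertColumn i₀ a G
          ≡⟨ cong₂ (λ k X → insertColumn k a X) (sym (trans (length-map (deleteAt a) Fp) i₀≡)) G≡ ⟩
        insertColumn (length (deleteColumn a Fp)) a (deleteColumn a Fp ++ r′ ∷ Fq)
          ≡⟨ insertColumn-++ (deleteColumn a Fp) a r′ Fq ⟩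
        padColumn a (deleteColumn a Fp) ++ insertAt a true r′ ∷ Fq
          ≡⟨ cong₂ (λ X x → X ++ x ∷ Fq) (padColumn-deleteColumn P-long hp clear) (reinsert one) ⟩
        F ∎
        where open ≡-Reasoning

      forward : ∀ {d} → T (columnCase d F) →
        MapsInto ν∖column (isTableauOfWeight ν∖column d) removeColumn restoreColumn F
      forward {d} t =
        let ((pt , w) , _) = to (T-cornerOne d F (not (oneAbove F))) t
        in mapsInto hG (from (T-isTableauOfWeight ν∖column d G) (from (isPermTableau⇔ hG) (delete (to PT⇔ pt)) ,
                                                                trans (sym weight) w))
                    restoreColumn-G

      backward : ∀ {d} → T (isTableauOfWeight ν∖column d G) →
        MapsInto ν (columnCase d) restoreColumn removeColumn G
      backward {d} t =
        let (ptG , w) = to (T-isTableauOfWeight ν∖column d G) t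
            pt = insert (≤-pred a<p) corner (trans entry-corner one) only-one (to (isPermTableau⇔ hG) ptG)
        in MapsInto-via restoreColumn-G hF (from (T-cornerOne d F (not (oneAbove F)))
                         ((from PT⇔ pt , trans weight w) , from T-≡ (trans cornerEntry≡ one) ,
                          from T-not-≡ (from zeros-above⇔ clear)))
                    refl

  count-cellCase : ∀ d → count (cellCase d) (allFillings ν) ≡ timesQ (numTableaux ν∖cell) d
  count-cellCase zero = count-none (cellCase 0) (allFillings ν) λ F∈ t → zero-case (allFillings-sound ν F∈) t
    where
    zero-case : ∀ {F} → HasShape ν F → ¬ T (cellCase 0 F)
    zero-case hs t with Fp , r , Fq , refl , hp , ℓ , hq ← HasShape-++-∷⁻ P hs =
      let open CornerRow r hp ℓ hq in
      CellDeletion.weight-positive (corner-one 0 (oneAbove F) t) t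
  count-cellCase (suc d) = trans
    (count-fillings-by-bijection (cellCase (suc d)) (isTableauOfWeight ν∖cell d) removeCell restoreCell into onto)
    (sym (numTableaux-count ν∖cell d))
    where
    into : ∀ {F} → HasShape ν F → T (cellCase (suc d) F) →
      MapsInto ν∖cell (isTableauOfWeight ν∖cell d) removeCell restoreCell F
    into hs t with Fp , r , Fq , refl , hp , ℓ , hq ← HasShape-++-∷⁻ P hs =
      let open CornerRow r hp ℓ hq in
      CellDeletion.forward (corner-one (suc d) (oneAbove F) t) t
    onto : ∀ {G} → HasShape ν∖cell G → T (isTableauOfWeight ν∖cell d G) →
      MapsInto ν (cellCase (suc d)) restoreCell removeCell G
    onto hs t with Gp , s , Gq , refl , hp , ℓ , hq ← HasShape-++-∷⁻ P hs =
      let (ℓ′ , one , back) = insertAt-corner ℓ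
          open CornerRow (insertAt a true s) hp ℓ′ hq
      in subst (λ X → T (isTableauOfWeight ν∖cell d X) →
                      MapsInto ν (cellCase (suc d)) restoreCell removeCell X)
               (cong (λ x → Gp ++ x ∷ Gq) back) (CellDeletion.backward one) t

  count-columnCase : ∀ d → count (columnCase d) (allFillings ν) ≡ numTableaux ν∖column d
  count-columnCase d = trans
    (count-fillings-by-bijection (columnCase d) (isTableauOfWeight ν∖column d) removeColumn restoreColumn into onto)
    (sym (numTableaux-count ν∖column d))
    where
    into : ∀ {F} → HasShape ν F → T (columnCase d F) →
      MapsInto ν∖column (isTableauOfWeight ν∖column d) removeColumn restoreColumn F
    into hs t with Fp , r , Fq , refl , hp , ℓ , hq ← HasShape-++-∷⁻ P hs =
      let open CornerRow r hp ℓ hq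
          (_ , _ , no-above) = to (T-cornerOne d F (not (oneAbove F))) t
      in ColumnDeletion.forward (corner-one d _ t) (to zeros-above⇔ (to T-not-≡ no-above)) t
    onto : ∀ {G} → HasShape ν∖column G → T (isTableauOfWeight ν∖column d G) →
      MapsInto ν (columnCase d) restoreColumn removeColumn G
    onto hs t with Gp , s , Gq , refl , hp , ℓ , hq ← HasShape-++-∷⁻ (map pred P) hs =
      let (ℓ′ , one , back) = insertAt-corner ℓ
          open CornerRow (insertAt a true s) (padColumn-shape P-long hp) ℓ′ hq
          clear = λ i lt → padColumn-zero P-long hp i (subst (i <_) (length-map (insertAt a false) Gp) lt)
          G≡ : ColumnDeletion.G one clear ≡ Gp ++ s ∷ Gq
          G≡ = trans (ColumnDeletion.G≡ one clear) (cong₂ (λ X x → X ++ x ∷ Gq) (deleteColumn-padColumn P-long hp) back)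
      in subst (λ X → T (isTableauOfWeight ν∖column d X) →
                      MapsInto ν (columnCase d) restoreColumn removeColumn X)
               G≡ (ColumnDeletion.backward one clear) t

  count-rowCase : ∀ d → count (rowCase d) (allFillings ν) ≡ numTableaux ν∖row d
  count-rowCase d = trans
    (count-fillings-by-bijection (rowCase d) (isTableauOfWeight ν∖row d) removeRow restoreRow into onto)
    (sym (numTableaux-count ν∖row d))
    where
    into : ∀ {F} → HasShape ν F → T (rowCase d F) →
      MapsInto ν∖row (isTableauOfWeight ν∖row d) removeRow restoreRow F
    into hs t with Fp , r , Fq , refl , hp , ℓ , hq ← HasShape-++-∷⁻ P hs =
      let open CornerRow r hp ℓ hq using (F; cornerEntry≡; zero-corner⇒zero-r)
          (tw , c) = to (T-∧ {isTableauOfWeight ν d F} {not (cornerEntry F)}) t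
          (pt , w) = to (T-isTableauOfWeight ν d F) tw
          open ZeroRowDeletion r hp ℓ hq (zero-corner⇒zero-r pt (trans (sym cornerEntry≡) (to T-not-≡ c))) hiding (F)
      in MapsInto-via deleteRow-F hG (from (T-isTableauOfWeight ν∖row d G) (to PT⇔ pt , trans (sym weight) w)) insertRow-G
    onto : ∀ {G} → HasShape ν∖row G → T (isTableauOfWeight ν∖row d G) →
      MapsInto ν (rowCase d) restoreRow removeRow G
    onto hs t with Fp , Fq , refl , hp , hq ← HasShape-++⁻ P hs =
      let zeros = getB-replicate-false (suc a)
          open CornerRow (replicate (suc a) false) hp (length-replicate (suc a)) hq using (F; cornerEntry≡)
          open ZeroRowDeletion (replicate (suc a) false) hp (length-replicate (suc a)) hq zeros hiding (F)
          (pt , w) = to (T-isTableauOfWeight ν∖row d G) t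
      in MapsInto-via insertRow-G hF
           (from T-∧ (from (T-isTableauOfWeight ν d F) (from PT⇔ pt , trans weight w) ,
                      from T-not-≡ (trans cornerEntry≡ (zeros a))))
           deleteRow-F

  corner-recursion : ∀ d →
    numTableaux ν d ≡ timesQ (numTableaux ν∖cell) d + numTableaux ν∖row d + numTableaux ν∖column d
  corner-recursion d = begin
    numTableaux ν d
      ≡⟨ numTableaux-count ν d ⟩
    count (isTableauOfWeight ν d) fillings
      ≡⟨ count-∧-split (isTableauOfWeight ν d) cornerEntry fillings ⟩
    count (λ F → isTableauOfWeight ν d F ∧ cornerEntry F) fillings + count (rowCase d) fillings
      ≡⟨ cong (_+ count (rowCase d) fillings) (count-∧-split _ oneAbove fillings) ⟩
    count (cellCase d) fillings + count (columnCase d) fillings + count (rowCase d) fillings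
      ≡⟨ cong₂ _+_ (cong₂ _+_ (count-cellCase d) (count-columnCase d)) (count-rowCase d) ⟩
    timesQ (numTableaux ν∖cell) d + numTableaux ν∖column d + numTableaux ν∖row d
      ≡⟨ xy∙z≈xz∙y (timesQ (numTableaux ν∖cell) d) _ _ ⟩
    timesQ (numTableaux ν∖cell) d + numTableaux ν∖row d + numTableaux ν∖column d ∎
    where
    open ≡-Reasoning
    fillings = allFillings ν

zeros : List Bool → ℕ
zeros [] = 0
zeros (true ∷ xs) = zeros xs
zeros (false ∷ xs) = suc (zeros xs)

-- rows (toList τ) is λ(τ): the first row has a cell for each 0 of τ, and each 1 of τ gives a
-- row with a cell for each 0 after it.
lowerRows : List Bool → List ℕ
lowerRows [] = []
lowerRows (true ∷ xs) = zeros xs ∷ lowerRows xs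
lowerRows (false ∷ xs) = lowerRows xs

rows : List Bool → List ℕ
rows xs = zeros xs ∷ lowerRows xs

letters : List Bool → List Letter
letters = map (λ b → if b then S else W)

countW-letters : ∀ xs → countW (letters xs) ≡ zeros xs
countW-letters [] = refl
countW-letters (true ∷ xs) = countW-letters xs
countW-letters (false ∷ xs) = cong suc (countW-letters xs)

wsBefore-letters : ∀ w xs → map (λ x → (w + zeros xs) ∸ x) (wsBefore w (letters xs)) ≡ lowerRows xs
wsBefore-letters w [] = refl
wsBefore-letters w (true ∷ xs) = cong₂ _∷_ (m+n∸m≡n w (zeros xs)) (wsBefore-letters w xs)
wsBefore-letters w (false ∷ xs) rewrite +-suc w (zeros xs) = wsBefore-letters (suc w) xs

shape≡rows : ∀ {n} (τ : Vec Bool n) → shape τ ≡ rows (toList τ)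
shape≡rows τ rewrite countW-letters (toList τ) = cong (zeros (toList τ) ∷_) (wsBefore-letters 0 (toList τ))

coeffW : List Bool → ℕ → ℕ
coeffW xs = numTableaux (rows xs)

zeros-++ : ∀ u v → zeros (u ++ v) ≡ zeros u + zeros v
zeros-++ [] v = refl
zeros-++ (true ∷ u) v = zeros-++ u v
zeros-++ (false ∷ u) v = cong suc (zeros-++ u v)

lowerRows-++ : ∀ u v → lowerRows (u ++ v) ≡ map (_+ zeros v) (lowerRows u) ++ lowerRows v
lowerRows-++ [] v = refl
lowerRows-++ (true ∷ u) v = cong₂ _∷_ (zeros-++ u v) (lowerRows-++ u v)
lowerRows-++ (false ∷ u) v = lowerRows-++ u v

rows-++ : ∀ u v → rows (u ++ v) ≡ map (_+ zeros v) (rows u) ++ lowerRows v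
rows-++ u v = cong₂ _∷_ (zeros-++ u v) (lowerRows-++ u v)

lowerRows≤zeros : ∀ v → All (_≤ zeros v) (lowerRows v)
lowerRows≤zeros [] = []
lowerRows≤zeros (true ∷ v) = ≤-refl ∷ lowerRows≤zeros v
lowerRows≤zeros (false ∷ v) = All.map m≤n⇒m≤1+n (lowerRows≤zeros v)

coeffW-corner : ∀ u v d → coeffW (u ++ true ∷ false ∷ v) d ≡
  timesQ (coeffW (u ++ false ∷ true ∷ v)) d + coeffW (u ++ false ∷ v) d + coeffW (u ++ true ∷ v) d
coeffW-corner u v d = begin
  numTableaux (rows (u ++ true ∷ false ∷ v)) d
    ≡⟨ cong (λ sh → numTableaux sh d) (shifted (true ∷ false ∷ v) refl) ⟩
  numTableaux ν d
    ≡⟨ corner-recursion d ⟩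
  timesQ (numTableaux ν∖cell) d + numTableaux ν∖row d + numTableaux ν∖column d
    ≡⟨ sym (cong₂ _+_ (cong₂ _+_ (cong (λ sh → timesQ (numTableaux sh) d) (shifted (false ∷ true ∷ v) refl))
                                  (cong (λ sh → numTableaux sh d) (shifted (false ∷ v) refl)))
                       (cong (λ sh → numTableaux sh d) lowered)) ⟩
  timesQ (coeffW (u ++ false ∷ true ∷ v)) d + coeffW (u ++ false ∷ v) d + coeffW (u ++ true ∷ v) d ∎
  where
  open ≡-Reasoning
  z = zeros v
  Q = lowerRows v
  open CornerRecursion (zeros u + z) (map (suc ∘ (_+ z)) (lowerRows u)) z Q
    (All-map⁺ (All.universal (λ x → s≤s (m≤n+m z x)) (rows u))) (lowerRows≤zeros v)
    using (P; ν; ν∖cell; ν∖row; ν∖column; corner-recursion)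
  shifted : ∀ w → zeros w ≡ suc z → rows (u ++ w) ≡ P ++ lowerRows w
  shifted w zw = trans (rows-++ u w)
    (cong (_++ lowerRows w) (map-cong (λ x → trans (cong (x +_) zw) (+-suc x z)) (rows u)))
  lowered : rows (u ++ true ∷ v) ≡ map pred P ++ z ∷ Q
  lowered = trans (rows-++ u (true ∷ v)) (cong (_++ z ∷ Q) (map-∘ (rows u)))

coeffW-empty-row : ∀ u v → zeros v ≡ 0 → ∀ d → coeffW (u ++ true ∷ v) d ≡ coeffW (u ++ v) d
coeffW-empty-row u v z≡0 d =
  subst₂ (λ sh sh′ → numTableaux sh d ≡ numTableaux sh′ d) (sym (rows-++ u (true ∷ v))) (sym (rows-++ u v)) drop-row
  where
  drop-row : numTableaux (map (_+ zeros v) (rows u) ++ zeros v ∷ lowerRows v) d ≡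
             numTableaux (map (_+ zeros v) (rows u) ++ lowerRows v) d
  drop-row rewrite z≡0 = numTableaux-empty-row (zeros u + 0) (map (_+ 0) (lowerRows u)) (lowerRows v) d

-- Monotonicity under a swap 01 → 10

-- In u ʳ++ w the prefix u is stored reversed, so letters move across the split point
-- definitionally; the induction below works in this form.
coeffW-cornerʳ : ∀ u v d → coeffW (u ʳ++ true ∷ false ∷ v) d ≡
  timesQ (coeffW (u ʳ++ false ∷ true ∷ v)) d + coeffW (u ʳ++ false ∷ v) d + coeffW (u ʳ++ true ∷ v) d
coeffW-cornerʳ u v d
  rewrite ʳ++-defn u {true ∷ false ∷ v} | ʳ++-defn u {false ∷ true ∷ v}
        | ʳ++-defn u {false ∷ v} | ʳ++-defn u {true ∷ v} = coeffW-corner (reverse u) v d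

coeffW-empty-rowʳ : ∀ u v → zeros v ≡ 0 → ∀ d → coeffW (u ʳ++ true ∷ v) d ≡ coeffW (u ʳ++ v) d
coeffW-empty-rowʳ u v z≡0 rewrite ʳ++-defn u {true ∷ v} | ʳ++-defn u {v} = coeffW-empty-row (reverse u) v z≡0

infix 4 _≤ᶜ_
_≤ᶜ_ : (ℕ → ℕ) → (ℕ → ℕ) → Set
f ≤ᶜ g = ∀ d → f d ≤ g d

timesQ-mono : ∀ {f g} → f ≤ᶜ g → timesQ f ≤ᶜ timesQ g
timesQ-mono f≤g zero = z≤n
timesQ-mono f≤g (suc d) = f≤g d

corner-mono : ∀ x y x′ y′ →
  coeffW (x ʳ++ false ∷ true ∷ y) ≤ᶜ coeffW (x′ ʳ++ false ∷ true ∷ y′) →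
  coeffW (x ʳ++ false ∷ y) ≤ᶜ coeffW (x′ ʳ++ false ∷ y′) →
  coeffW (x ʳ++ true ∷ y) ≤ᶜ coeffW (x′ ʳ++ true ∷ y′) →
  coeffW (x ʳ++ true ∷ false ∷ y) ≤ᶜ coeffW (x′ ʳ++ true ∷ false ∷ y′)
corner-mono x y x′ y′ swapped zero-deleted one-deleted d = begin
  coeffW (x ʳ++ true ∷ false ∷ y) d
    ≡⟨ coeffW-cornerʳ x y d ⟩
  timesQ (coeffW (x ʳ++ false ∷ true ∷ y)) d + coeffW (x ʳ++ false ∷ y) d + coeffW (x ʳ++ true ∷ y) d
    ≤⟨ +-mono-≤ (+-mono-≤ (timesQ-mono swapped d) (zero-deleted d)) (one-deleted d) ⟩
  timesQ (coeffW (x′ ʳ++ false ∷ true ∷ y′)) d + coeffW (x′ ʳ++ false ∷ y′) d + coeffW (x′ ʳ++ true ∷ y′) d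
    ≡⟨ sym (coeffW-cornerʳ x′ y′ d) ⟩
  coeffW (x′ ʳ++ true ∷ false ∷ y′) d ∎
  where open ≤-Reasoning

inversions : List Bool → ℕ
inversions [] = 0
inversions (true ∷ v) = zeros v + inversions v
inversions (false ∷ v) = inversions v

disorder : List Bool → ℕ
disorder v = length v + inversions v

inversions-swap : ∀ w v → inversions (w ++ true ∷ false ∷ v) ≡ suc (inversions (w ++ false ∷ true ∷ v))
inversions-swap [] v = refl
inversions-swap (false ∷ w) v = inversions-swap w v
inversions-swap (true ∷ w) v = begin
  zeros (w ++ true ∷ false ∷ v) + inversions (w ++ true ∷ false ∷ v)
    ≡⟨ cong₂ _+_ (trans (zeros-++ w _) (sym (zeros-++ w _))) (inversions-swap w v) ⟩
  zeros (w ++ false ∷ true ∷ v) + suc (inversions (w ++ false ∷ true ∷ v))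
    ≡⟨ +-suc _ _ ⟩
  suc (zeros (w ++ false ∷ true ∷ v) + inversions (w ++ false ∷ true ∷ v)) ∎
  where open ≡-Reasoning

inversions-delete : ∀ w x v → inversions (w ++ v) ≤ inversions (w ++ x ∷ v)
inversions-delete [] true v = m≤n+m (inversions v) (zeros v)
inversions-delete [] false v = ≤-refl
inversions-delete (false ∷ w) x v = inversions-delete w x v
inversions-delete (true ∷ w) x v = +-mono-≤ (zeros-delete x) (inversions-delete w x v)
  where
  zeros-delete : ∀ x → zeros (w ++ v) ≤ zeros (w ++ x ∷ v)
  zeros-delete x = begin
    zeros (w ++ v)          ≡⟨ zeros-++ w v ⟩
    zeros w + zeros v       ≤⟨ +-monoʳ-≤ (zeros w) (zeros-≤ x) ⟩
    zeros w + zeros (x ∷ v) ≡⟨ sym (zeros-++ w (x ∷ v)) ⟩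
    zeros (w ++ x ∷ v)      ∎
    where
    open ≤-Reasoning
    zeros-≤ : ∀ x → zeros v ≤ zeros (x ∷ v)
    zeros-≤ true = ≤-refl
    zeros-≤ false = n≤1+n _

disorder-swap : ∀ w v → disorder (w ++ false ∷ true ∷ v) < disorder (w ++ true ∷ false ∷ v)
disorder-swap w v = begin-strict
  length (w ++ false ∷ true ∷ v) + inversions (w ++ false ∷ true ∷ v)
    <⟨ +-monoʳ-< (length (w ++ false ∷ true ∷ v)) (n<1+n _) ⟩
  length (w ++ false ∷ true ∷ v) + suc (inversions (w ++ false ∷ true ∷ v))
    ≡⟨ cong₂ _+_ (trans (length-++ w {false ∷ true ∷ v}) (sym (length-++ w))) (sym (inversions-swap w v)) ⟩
  length (w ++ true ∷ false ∷ v) + inversions (w ++ true ∷ false ∷ v) ∎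
  where open ≤-Reasoning

disorder-delete : ∀ w x v → disorder (w ++ v) < disorder (w ++ x ∷ v)
disorder-delete w x v = begin-strict
  length (w ++ v) + inversions (w ++ v)
    <⟨ +-monoˡ-< (inversions (w ++ v)) (n<1+n _) ⟩
  suc (length (w ++ v)) + inversions (w ++ v)
    ≤⟨ +-mono-≤ (≤-reflexive (sym (length-insert w x v))) (inversions-delete w x v) ⟩
  length (w ++ x ∷ v) + inversions (w ++ x ∷ v) ∎
  where open ≤-Reasoning

disorder-delete-after : ∀ w x y v → disorder (w ++ x ∷ v) < disorder (w ++ x ∷ y ∷ v)
disorder-delete-after w x y v = subst₂ _<_ (cong disorder (∷ʳ-++ w x v)) (cong disorder (∷ʳ-++ w x (y ∷ v)))
  (disorder-delete (w ∷ʳ x) y v)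

data SuffixView : List Bool → Set where
  no-zeros     : ∀ {v} → zeros v ≡ 0 → SuffixView v
  leading-zero : ∀ v → SuffixView (false ∷ v)
  has-corner   : ∀ w v → SuffixView (w ++ true ∷ false ∷ v)

suffixView : ∀ v → SuffixView v
suffixView [] = no-zeros refl
suffixView (false ∷ v) = leading-zero v
suffixView (true ∷ v) with suffixView v
... | no-zeros z≡0     = no-zeros z≡0
... | leading-zero v′  = has-corner [] v′
... | has-corner w v′  = has-corner (true ∷ w) v′

-- Both sides are expanded at a common corner: a factor 10 inside v, or the one formed by a
-- leading 0 of v.  If v has no 0, the 1 of the swapped pair is an empty row.
swap-mono-acc : ∀ u v → Acc _<_ (disorder v) →
  coeffW (u ʳ++ false ∷ true ∷ v) ≤ᶜ coeffW (u ʳ++ true ∷ false ∷ v)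
swap-mono-acc u v (acc rec) with suffixView v
... | no-zeros z≡0 = λ d → begin
  coeffW (u ʳ++ false ∷ true ∷ v) d ≡⟨ coeffW-empty-rowʳ (false ∷ u) v z≡0 d ⟩
  coeffW (u ʳ++ false ∷ v) d        ≤⟨ m≤n+m _ _ ⟩
  timesQ (coeffW (u ʳ++ false ∷ true ∷ v)) d + coeffW (u ʳ++ false ∷ v) d
                                    ≤⟨ m≤m+n _ _ ⟩
  timesQ (coeffW (u ʳ++ false ∷ true ∷ v)) d + coeffW (u ʳ++ false ∷ v) d + coeffW (u ʳ++ true ∷ v) d
                                    ≡⟨ sym (coeffW-cornerʳ u v d) ⟩
  coeffW (u ʳ++ true ∷ false ∷ v) d ∎
  where open ≤-Reasoning
... | leading-zero v′ =
  corner-mono (false ∷ u) v′ u (false ∷ v′) (swap-mono-acc (false ∷ u) v′ (rec (n<1+n _))) (λ _ → ≤-refl)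
    (swap-mono-acc u v′ (rec (n<1+n _)))
... | has-corner w v′ =
  transport (true ∷ false ∷ v′) (corner-mono (prefix (false ∷ true ∷ w)) v′ (prefix (true ∷ false ∷ w)) v′
    (lifted (false ∷ true ∷ v′) (disorder-swap w v′))
    (lifted (false ∷ v′) (disorder-delete w true (false ∷ v′)))
    (lifted (true ∷ v′) (disorder-delete-after w true false v′)))
  where
  prefix : List Bool → List Bool
  prefix block = block ʳ++ u
  transport : ∀ z → coeffW (prefix (false ∷ true ∷ w) ʳ++ z) ≤ᶜ coeffW (prefix (true ∷ false ∷ w) ʳ++ z) →
    coeffW (u ʳ++ false ∷ true ∷ w ++ z) ≤ᶜ coeffW (u ʳ++ true ∷ false ∷ w ++ z)
  transport z = subst₂ _≤ᶜ_ (cong coeffW (ʳ++-ʳ++ (false ∷ true ∷ w))) (cong coeffW (ʳ++-ʳ++ (true ∷ false ∷ w)))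
  lifted : ∀ z → disorder (w ++ z) < disorder (w ++ true ∷ false ∷ v′) →
    coeffW (prefix (false ∷ true ∷ w) ʳ++ z) ≤ᶜ coeffW (prefix (true ∷ false ∷ w) ʳ++ z)
  lifted z lt = subst₂ _≤ᶜ_
    (cong coeffW (sym (ʳ++-ʳ++ (false ∷ true ∷ w)))) (cong coeffW (sym (ʳ++-ʳ++ (true ∷ false ∷ w))))
    (swap-mono-acc u (w ++ z) (rec lt))

swap-mono : ∀ u v → coeffW (u ++ false ∷ true ∷ v) ≤ᶜ coeffW (u ++ true ∷ false ∷ v)
swap-mono u v = subst₂ _≤ᶜ_ (cong coeffW (zipper (false ∷ true ∷ v))) (cong coeffW (zipper (true ∷ false ∷ v)))
  (swap-mono-acc (reverse u) v (<-wellFounded _))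
  where
  zipper : ∀ w → reverse u ʳ++ w ≡ u ++ w
  zipper w = trans (ʳ++-defn (reverse u)) (cong (_++ w) (reverse-involutive u))

-- Dominance and swaps

infix 4 _⇝_ _⇝*_
data _⇝_ : List Bool → List Bool → Set where
  swap : ∀ u v → u ++ false ∷ true ∷ v ⇝ u ++ true ∷ false ∷ v

_⇝*_ : List Bool → List Bool → Set
_⇝*_ = Star _⇝_

⇝*-mono : ∀ {xs ys} → xs ⇝* ys → coeffW xs ≤ᶜ coeffW ys
⇝*-mono ε d = ≤-refl
⇝*-mono (swap u v ◅ steps) d = ≤-trans (swap-mono u v d) (⇝*-mono steps d)

⇝*-cons : ∀ b {xs ys} → xs ⇝* ys → b ∷ xs ⇝* b ∷ ys
⇝*-cons b = gmap (b ∷_) λ { (swap u v) → swap (b ∷ u) v }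

bubble : ∀ k ρ → replicate k false ++ true ∷ ρ ⇝* true ∷ replicate k false ++ ρ
bubble zero ρ = ε
bubble (suc k) ρ = ⇝*-cons false (bubble k ρ) ◅◅ swap [] (replicate k false ++ ρ) ◅ ε

zeros+ones : ∀ xs → zeros xs + ones xs ≡ length xs
zeros+ones [] = refl
zeros+ones (true ∷ xs) = trans (+-suc (zeros xs) (ones xs)) (cong suc (zeros+ones xs))
zeros+ones (false ∷ xs) = cong suc (zeros+ones xs)

firstOne : ∀ xs → (∃[ k ] ∃[ ρ ] xs ≡ replicate k false ++ true ∷ ρ) ⊎ zeros xs ≡ length xs
firstOne [] = inj₂ refl
firstOne (true ∷ xs) = inj₁ (0 , xs , refl)
firstOne (false ∷ xs) with firstOne xs
... | inj₁ (k , ρ , refl) = inj₁ (suc k , ρ , refl)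
... | inj₂ all-zero = inj₂ (cong suc all-zero)

zeros-zeros++ : ∀ k xs → zeros (replicate k false ++ xs) ≡ k + zeros xs
zeros-zeros++ zero xs = refl
zeros-zeros++ (suc k) xs = cong suc (zeros-zeros++ k xs)

lowerRows-zeros++ : ∀ k xs → lowerRows (replicate k false ++ xs) ≡ lowerRows xs
lowerRows-zeros++ zero xs = refl
lowerRows-zeros++ (suc k) xs = lowerRows-zeros++ k xs

zeros≤length : ∀ xs → zeros xs ≤ length xs
zeros≤length xs = subst (zeros xs ≤_) (zeros+ones xs) (m≤m+n _ _)

dominance⇒⇝* : ∀ xs ys → length xs ≡ length ys → zeros xs ≡ zeros ys →
  lowerRows xs ⊆ᵈ lowerRows ys → xs ⇝* ys
dominance⇒⇝* [] [] _ _ _ = ε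
dominance⇒⇝* (true ∷ xs) (true ∷ ys) ℓ z ⊆ =
  ⇝*-cons true (dominance⇒⇝* xs ys (suc-injective ℓ) z (⊆ ∘ suc))
dominance⇒⇝* (false ∷ xs) (false ∷ ys) ℓ z ⊆ =
  ⇝*-cons false (dominance⇒⇝* xs ys (suc-injective ℓ) (suc-injective z) ⊆)
dominance⇒⇝* (true ∷ xs) (false ∷ ys) ℓ z ⊆ = ⊥-elim (1+n≰n (begin
  suc (zeros ys)               ≡⟨ sym z ⟩
  zeros xs                     ≤⟨ ⊆ 0 ⟩
  part (lowerRows ys) 0        ≤⟨ part-bounded (lowerRows ys) (lowerRows≤zeros ys) 0 ⟩
  zeros ys                     ∎))
  where open ≤-Reasoning
dominance⇒⇝* (false ∷ xs) (true ∷ ys) ℓ z ⊆ with firstOne xs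
... | inj₂ all-zero = ⊥-elim (1+n≰n (begin
  suc (length ys) ≡⟨ sym ℓ ⟩
  suc (length xs) ≡⟨ cong suc (sym all-zero) ⟩
  suc (zeros xs)  ≡⟨ z ⟩
  zeros ys        ≤⟨ zeros≤length ys ⟩
  length ys       ∎))
  where open ≤-Reasoning
... | inj₁ (k , ρ , refl) = bubble (suc k) ρ ◅◅ ⇝*-cons true
  (dominance⇒⇝* (replicate (suc k) false ++ ρ) ys ℓ′ z′
    (λ i → subst (λ sh → part sh i ≤ part (lowerRows ys) i) (sym (lowerRows-zeros++ k ρ))
             (subst (λ sh → part sh (suc i) ≤ part (lowerRows ys) i) (lowerRows-zeros++ k (true ∷ ρ)) (⊆ (suc i)))))
  where
  ℓ′ : length (replicate (suc k) false ++ ρ) ≡ length ys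
  ℓ′ = trans (sym (length-insert (replicate k false) true ρ)) (suc-injective ℓ)
  z′ : zeros (replicate (suc k) false ++ ρ) ≡ zeros ys
  z′ = trans (zeros-zeros++ (suc k) ρ) (trans (sym (zeros-zeros++ (suc k) (true ∷ ρ))) z)

same-zeros : ∀ xs ys → length xs ≡ length ys → ones xs ≡ ones ys → zeros xs ≡ zeros ys
same-zeros xs ys ℓ o = +-cancelʳ-≡ (ones xs) (zeros xs) (zeros ys)
  (trans (zeros+ones xs) (trans ℓ (trans (sym (zeros+ones ys)) (cong (zeros ys +_) (sym o)))))

coeff≡coeffW : ∀ {n} (τ : Vec Bool n) d → coeff τ d ≡ coeffW (toList τ) d
coeff≡coeffW τ d = cong (λ sh → numTableaux sh d) (shape≡rows τ)

proposition5p3 : (n : ℕ) → 1 ≤ n → (τ τ' : Vec Bool n) → τ ≺ τ' →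
    ∀ (d : ℕ) → coeff τ d ≤ coeff τ' d
proposition5p3 n _ τ τ′ (same-ones , λ⊆μ) d =
  subst₂ _≤_ (sym (coeff≡coeffW τ d)) (sym (coeff≡coeffW τ′ d)) (⇝*-mono swaps d)
  where
  same-length : length (toList τ) ≡ length (toList τ′)
  same-length = trans (length-toList τ) (sym (length-toList τ′))
  lower⊆ : lowerRows (toList τ) ⊆ᵈ lowerRows (toList τ′)
  lower⊆ i = subst₂ (λ sh sh′ → part sh (suc i) ≤ part sh′ (suc i)) (shape≡rows τ) (shape≡rows τ′) (λ⊆μ (suc i))
  swaps : toList τ ⇝* toList τ′
  swaps = dominance⇒⇝* (toList τ) (toList τ′) same-length
            (same-zeros (toList τ) (toList τ′) same-length same-ones) lower⊆
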